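{- Let $U$ be a totally-isotropic $n$-dimensional subspace of $V$, with $R, L$ such that $X_U=R\rtimes L$ (the Levi decomposition described in the context), and let $\mathcal{H}$ denote the set of all $(n-1)$-dimensional subspaces of $U$. For each $H \in \mathcal{H}$ define $P_H := \{ \varphi \in \mathcal{Q}^- \mid \mathrm{sing}(\varphi)\cap U = H \}$. \begin{enumerate}[(a)] \item The subgroup $X_U$ is transitive on $\mathcal{Q}^-$. \item Let $\varphi \in \mathcal{Q}^-$, $H=\mathrm{sing}(\varphi)\cap U$, and $c\in V$. Then $\varphi_c \in P_H$ if and only if $c\in H$. In particular $|P_H|=2^{n-1}$. \item $\mathcal{P}=\{P_H \mid H \in \mathcal{H}\}$ is a system of imprimitivity for the action of $X_U$ on $\mathcal{Q}^-$. Moreover the $X_U$-actions on $\mathcal{H}$ and $\mathcal{P}$ are permutationally isomorphic. \item The transitive actions of $L$ on $\mathcal{P}$, and of $\mathrm{GL}(U)$ on $\mathcal{H}$, are permutationally isomorphic. In particular, $|P_H|=2^{n-1}$ for any $H\in\mathcal{H}$. \item The kernel of the $X_U$-action on $\mathcal{P}$ is $R$, and the group $X_U^\mathcal{P}$ induced by $X_U$ on $\mathcal{P}$ is $L^\mathcal{P}\cong L$. \end{enumerate}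
   Context: $(V,B)=(\mathbb{F}_2^{2n},B)$ is a symplectic space with $n\ge 2$ and $X=\mathrm{Sp}_{2n}(2)$ is the isometry group of $B$. $\mathcal{Q}^-$ denotes the set of quadratic forms $\varphi:V\to\mathbb{F}_2$ of minus (elliptic) type polarising to $B$, i.e. $B(x,y)=\varphi(x+y)+\varphi(x)+\varphi(y)$. $X$ acts on such forms by $\varphi^g(x)=\varphi(xg^{ -1})$. For $\varphi$ a form, $\mathrm{sing}(\varphi)=\{x\in V\mid \varphi(x)=0\}$, and for $c\in V$, $\varphi_c$ is the form $\varphi_c(v)=\varphi(v)+B(v,c)^2$. $X_U$ is the setwise stabiliser of $U$ in $X$. Take a symplectic basis $e_1,\dots,e_n,f_1,\dots,f_n$ with $U=\langle e_1,\dots,e_n\rangle$; with respect to this basis $X_U=R\rtimes L$ where $L=\{\mathrm{diag}(a,a^{ -T}) : a\in\mathrm{GL}_n(2)\}\cong \mathrm{GL}_n(2)$ (the Levi factor, stabilising $U$ and $\langle f_1,\dots,f_n\rangle$) and $R=\left\{\begin{pmatrix} I_n & 0\\ Q & I_n\end{pmatrix} : Q=Q^T\right\}$ (the unipotent radical, acting trivially on $U$ and on $V/U$), so $|R|=2^{n(n+1)/2}$. -}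

module Defs where

open import Data.Nat using (ℕ; zero; suc; _≤_; _∸_)
open import Data.Bool using (Bool; true; false; _xor_; _∧_; if_then_else_)
open import Data.Fin using (Fin; _≟_)
open import Data.Vec using (Vec; []; _∷_; zipWith; foldr; replicate; map; tabulate; transpose; lookup)
open import Data.Product using (Σ; _×_; _,_; proj₁; proj₂)
open import Relation.Binary.PropositionalEquality using (_≡_)
open import Relation.Nullary using (¬_; does)
open import Function.Bundles using (_⇔_)

-- Vectors over F₂ = Bool (xor = +, ∧ = ·)

Vec₂ : ℕ → Set
Vec₂ n = Vec Bool n

zeros : ∀ {n} → Vec₂ n
zeros = replicate _ false

_⊕v_ : ∀ {n} → Vec₂ n → Vec₂ n → Vec₂ n
_⊕v_ = zipWith _xor_

dot : ∀ {n} → Vec₂ n → Vec₂ n → Bool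
dot u w = foldr _ _xor_ false (zipWith _∧_ u w)

-- n×n matrices, stored as a vector of rows
Mat : ℕ → Set
Mat n = Vec (Vec₂ n) n

vecMat : ∀ {m n} → Vec₂ m → Vec (Vec₂ n) m → Vec₂ n
vecMat [] [] = zeros
vecMat (c ∷ cs) (r ∷ rs) = (if c then r else zeros) ⊕v vecMat cs rs

_·m_ : ∀ {n} → Mat n → Mat n → Mat n
A ·m B = map (λ r → vecMat r B) A

idMat : ∀ {n} → Mat n
idMat = tabulate (λ i → tabulate (λ j → does (i ≟ j)))

IsInvPair : ∀ {n} → Mat n → Mat n → Set
IsInvPair A A' = (A ·m A' ≡ idMat) × (A' ·m A ≡ idMat)

-- The symplectic space V = F₂^{2n}, coordinates w.r.t. the symplectic
-- basis e₁..eₙ,f₁..fₙ : a vector is (a , b) meaning Σ aᵢeᵢ + Σ bᵢfᵢ.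

V : ℕ → Set
V n = Vec₂ n × Vec₂ n

zeroV : ∀ {n} → V n
zeroV = zeros , zeros

_⊕_ : ∀ {n} → V n → V n → V n
(a , b) ⊕ (c , d) = (a ⊕v c) , (b ⊕v d)

-- symplectic form: B(eᵢ,fⱼ)=B(fⱼ,eᵢ)=δᵢⱼ, B(eᵢ,eⱼ)=B(fᵢ,fⱼ)=0
B : ∀ {n} → V n → V n → Bool
B (a , b) (c , d) = dot a d xor dot b c

-- U = ⟨e₁,…,eₙ⟩
InU : ∀ {n} → V n → Set
InU (a , b) = b ≡ zeros

lin : ∀ {n k} → Vec Bool k → Vec (V n) k → V n
lin [] [] = zeroV
lin (c ∷ cs) (v ∷ vs) = (if c then v else zeroV) ⊕ lin cs vs

Independent : ∀ {n k} → Vec (V n) k → Set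
Independent {k = k} vs = ∀ c → lin c vs ≡ zeroV → c ≡ replicate k false

record Subsp (n k : ℕ) : Set where
  field
    basis : Vec (V n) k
    indep : Independent basis

_∈S_ : ∀ {n k} → V n → Subsp n k → Set
_∈S_ {k = k} x S = Σ (Vec Bool k) λ c → lin c (Subsp.basis S) ≡ x

Form : ℕ → Set
Form n = V n → Bool

Polarises : ∀ {n} → Form n → Set
Polarises φ = ∀ x y → B x y ≡ (φ (x ⊕ y) xor φ x) xor φ y

TotSing : ∀ {n k} → Form n → Subsp n k → Set
TotSing φ S = ∀ x → x ∈S S → φ x ≡ false

WittIndex : ∀ {n} → Form n → ℕ → Set
WittIndex {n} φ k =
  (Σ (Subsp n k) λ S → TotSing φ S) ×
  (∀ m (S : Subsp n m) → TotSing φ S → m ≤ k)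

MinusType : ∀ {n} → Form n → Set
MinusType {n} φ = WittIndex φ (n ∸ 1)

QM : ∀ {n} → Form n → Set
QM φ = Polarises φ × MinusType φ

-- φ_c(v) = φ(v) + B(v,c)²  (over F₂, B(v,c)² = B(v,c) ∧ B(v,c))
shift : ∀ {n} → Form n → V n → Form n
shift φ c v = φ v xor (B v c ∧ B v c)

singU : ∀ {n} → Form n → V n → Set
singU φ x = InU x × (φ x ≡ false)

InP : ∀ {n} → (V n → Set) → Form n → Set
InP H ψ = QM ψ × (∀ x → singU ψ x ⇔ H x)

_≗F_ : ∀ {n} → Form n → Form n → Set
φ ≗F ψ = ∀ x → φ x ≡ ψ x

Hyp : ℕ → Set
Hyp n = Σ (Subsp n (n ∸ 1)) λ S → ∀ x → x ∈S S → InU x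

memH : ∀ {n} → Hyp n → V n → Set
memH H x = x ∈S proj₁ H

-- X = Sp_{2n}(2): invertible linear isometries of (V,B).
-- (Linear over F₂ = additive.)

record Isom (n : ℕ) : Set where
  field
    fun      : V n → V n            -- x ↦ x g
    inv      : V n → V n            -- x ↦ x g⁻¹
    inv-fun  : ∀ v → inv (fun v) ≡ v
    fun-inv  : ∀ v → fun (inv v) ≡ v
    additive : ∀ u v → fun (u ⊕ v) ≡ fun u ⊕ fun v
    isometry : ∀ u v → B (fun u) (fun v) ≡ B u v
open Isom public

act : ∀ {n} → Isom n → Form n → Form n
act g φ x = φ (inv g x)

InXU : ∀ {n} → Isom n → Set
InXU g = ∀ x → InU x ⇔ InU (fun g x)

imgH : ∀ {n} → Isom n → Hyp n → V n → Set
imgH g H x = memH H (inv g x)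

-- R = { [[I,0],[Q,I]] : Q = Qᵀ } :  (a , b) ↦ (a + bQ , b)
Rmap : ∀ {n} → Mat n → V n → V n
Rmap Q (a , b) = (a ⊕v vecMat b Q) , b

InR : ∀ {n} → Isom n → Set
InR {n} g = Σ (Mat n) λ Q → (transpose Q ≡ Q) × (∀ v → fun g v ≡ Rmap Q v)

-- L = { diag(A, A^{-T}) } :  (a , b) ↦ (a A , b A'ᵀ)  where A' = A⁻¹
Lmap : ∀ {n} → Mat n → Mat n → V n → V n
Lmap A A' (a , b) = vecMat a A , vecMat b (transpose A')

-- GL(U) ≅ GL_n(2) acting on U by (a , 0) ↦ (a A , 0);
-- image of H under A (A' = A⁻¹):  x ∈ H^A ⇔ x ∈ U and x A⁻¹ ∈ H
imgA : ∀ {n} → Mat n → Hyp n → V n → Set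
imgA A' H x = InU x × memH H (vecMat (proj₁ x) A' , zeros)

-- "the set { a | P a } (modulo ≈) has exactly k elements"

Card : {A : Set} → (A → A → Set) → (A → Set) → ℕ → Set
Card {A} _≈_ P k =
  Σ (Vec A k) λ xs →
    (∀ i → P (lookup xs i)) ×
    (∀ i j → lookup xs i ≈ lookup xs j → i ≡ j) ×
    (∀ a → P a → Σ (Fin k) λ i → a ≈ lookup xs i)

module Submission where

-- Every form polarising to B is φ[ p ] = φ₀ + B(·, p) for the hyperbolic form φ₀ (a , b) = a · b, and φ[ p ]
-- is of minus type iff φ₀ p = 1: the character sum Σ (-1)^φ[ p ] = (-1)^(φ₀ p) 2ⁿ bounds the totally singular
-- subspaces, and for φ₀ p = 0 one writes down an n-dimensional one. On U, φ[ p ] is a ↦ a · p₂, so sing(φ[ p ]) ∩ U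
-- is the hyperplane of U with normal p₂, and P_H = { φ[ r ] | r₂ = h, r₁ · h = 1 } when h is normal to H: a coset
-- of H, of size 2ⁿ⁻¹. L = { diag(A, A⁻ᵀ) } moves p₂ through GL(U), which is transitive on nonzero normals
-- (transvections), and R shifts p₁ by p₂ Q for symmetric Q; together they reach every p with φ₀ p = 1. Conversely
-- an element of X_U fixing every P_H fixes every hyperplane of U, hence U pointwise, and the isometries fixing U
-- pointwise are exactly R.

open import Defs
open import Data.Bool using (Bool; true; false; not; _∧_; _xor_; if_then_else_)
open import Data.Bool.Properties
  using (xor-assoc; xor-comm; xor-identityˡ; xor-identityʳ; xor-same;
         ∧-comm; ∧-idem; ∧-zeroʳ; ∧-identityʳ; ∧-distribʳ-xor)
open import Data.Bool.Solver using (module xor-∧-Solver)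
open import Data.Empty using (⊥; ⊥-elim)
open import Data.Fin using (Fin; zero; suc; _≟_; remQuot; combine)
open import Data.Fin.Properties using (remQuot-combine; combine-remQuot)
open import Data.Nat using (ℕ; zero; suc; _∸_; _^_)
import Data.Nat as ℕ
import Data.Nat.Properties as ℕ
open import Data.Product using (Σ; _×_; _,_; proj₁; proj₂)
open import Data.Sum using (_⊎_; inj₁; inj₂)
open import Data.Vec using (Vec; []; _∷_; zipWith; replicate; map; tabulate; transpose; lookup; tail)
open import Data.Vec.Properties
  using (zipWith-assoc; zipWith-comm; zipWith-identityˡ; zipWith-is-⊛; tabulate-∘; lookup∘tabulate)
open import Function.Bundles using (_⇔_; mk⇔; module Equivalence)
open import Function.Properties.Equivalence using (⇔-isEquivalence)
open import Level using (0ℓ)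
open import Relation.Binary.PropositionalEquality
open import Relation.Binary.Structures using (IsEquivalence)
open import Relation.Nullary using (¬_; does; yes; no)

open Equivalence using (to; from)
module ⇔ = IsEquivalence (⇔-isEquivalence {ℓ = 0ℓ})
open xor-∧-Solver using (solve; _:+_; _:*_; _:=_; con)

module ExponentTwo {A : Set} (_+_ : A → A → A) (0# : A)
  (+-assoc : ∀ x y z → (x + y) + z ≡ x + (y + z))
  (+-comm : ∀ x y → x + y ≡ y + x)
  (+-identityˡ : ∀ x → 0# + x ≡ x)
  (+-self : ∀ x → x + x ≡ 0#)
  where

  +-identityʳ : ∀ x → x + 0# ≡ x
  +-identityʳ x = trans (+-comm x 0#) (+-identityˡ x)

  x+[x+y]≡y : ∀ x y → x + (x + y) ≡ y
  x+[x+y]≡y x y = trans (sym (+-assoc x x y)) (trans (cong (_+ y) (+-self x)) (+-identityˡ y))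

  +-cancelˡ-≡ : ∀ x {y z} → x + y ≡ x + z → y ≡ z
  +-cancelˡ-≡ x {y} {z} e = trans (sym (x+[x+y]≡y x y)) (trans (cong (x +_) e) (x+[x+y]≡y x z))

  [x+y]+y≡x : ∀ x y → (x + y) + y ≡ x
  [x+y]+y≡x x y = trans (+-assoc x y y) (trans (cong (x +_) (+-self y)) (+-identityʳ x))

  x+y≡0⇒x≡y : ∀ x y → x + y ≡ 0# → x ≡ y
  x+y≡0⇒x≡y x y e = +-cancelˡ-≡ x (trans (+-self x) (sym e))

  +-interchange : ∀ a b c d → (a + b) + (c + d) ≡ (a + c) + (b + d)
  +-interchange a b c d = begin
    (a + b) + (c + d)  ≡⟨ +-assoc a b (c + d) ⟩
    a + (b + (c + d))  ≡⟨ cong (a +_) (sym (+-assoc b c d)) ⟩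
    a + ((b + c) + d)  ≡⟨ cong (λ t → a + (t + d)) (+-comm b c) ⟩
    a + ((c + b) + d)  ≡⟨ cong (a +_) (+-assoc c b d) ⟩
    a + (c + (b + d))  ≡⟨ sym (+-assoc a c (b + d)) ⟩
    (a + c) + (b + d)  ∎
    where open ≡-Reasoning

module Xor = ExponentTwo _xor_ false xor-assoc xor-comm xor-identityˡ xor-same

≡-by-true : ∀ {x y} → (x ≡ true ⇔ y ≡ true) → x ≡ y
≡-by-true {true} x⇔y = sym (to x⇔y refl)
≡-by-true {false} {true} x⇔y = from x⇔y refl
≡-by-true {false} {false} x⇔y = refl

x≡true⇔x+1≡false : ∀ x → (x ≡ true) ⇔ (x xor true ≡ false)
x≡true⇔x+1≡false true = mk⇔ (λ _ → refl) (λ _ → refl)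
x≡true⇔x+1≡false false = mk⇔ (λ ()) (λ ())

≡-by-false : ∀ {x y} → (x ≡ false ⇔ y ≡ false) → x ≡ y
≡-by-false {false} x⇔y = sym (to x⇔y refl)
≡-by-false {true} {false} x⇔y = from x⇔y refl
≡-by-false {true} {true} x⇔y = refl

⊕v-assoc : ∀ {n} (u v w : Vec₂ n) → (u ⊕v v) ⊕v w ≡ u ⊕v (v ⊕v w)
⊕v-assoc = zipWith-assoc xor-assoc

⊕v-comm : ∀ {n} (u v : Vec₂ n) → u ⊕v v ≡ v ⊕v u
⊕v-comm = zipWith-comm xor-comm

⊕v-identityˡ : ∀ {n} (u : Vec₂ n) → zeros ⊕v u ≡ u
⊕v-identityˡ = zipWith-identityˡ xor-identityˡ

⊕v-self : ∀ {n} (u : Vec₂ n) → u ⊕v u ≡ zeros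
⊕v-self [] = refl
⊕v-self (x ∷ u) = cong₂ _∷_ (xor-same x) (⊕v-self u)

module ⊕v {n} = ExponentTwo (_⊕v_ {n}) zeros ⊕v-assoc ⊕v-comm ⊕v-identityˡ ⊕v-self

infixr 25 _·v_

_·v_ : ∀ {n} → Bool → Vec₂ n → Vec₂ n
c ·v r = if c then r else zeros

·v-distribʳ-xor : ∀ {n} a b (r : Vec₂ n) → (a xor b) ·v r ≡ a ·v r ⊕v b ·v r
·v-distribʳ-xor true true r = sym (⊕v-self r)
·v-distribʳ-xor true false r = sym (⊕v.+-identityʳ r)
·v-distribʳ-xor false b r = sym (⊕v-identityˡ _)

·v-distribˡ-⊕v : ∀ {n} a (r s : Vec₂ n) → a ·v (r ⊕v s) ≡ a ·v r ⊕v a ·v s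
·v-distribˡ-⊕v true r s = refl
·v-distribˡ-⊕v false r s = sym (⊕v-identityˡ zeros)

·v-zeroʳ : ∀ {n} a → a ·v zeros {n} ≡ zeros
·v-zeroʳ true = refl
·v-zeroʳ false = refl

dot-zeroˡ : ∀ {n} (w : Vec₂ n) → dot zeros w ≡ false
dot-zeroˡ [] = refl
dot-zeroˡ (x ∷ w) = dot-zeroˡ w

dot-zeroʳ : ∀ {n} (w : Vec₂ n) → dot w zeros ≡ false
dot-zeroʳ [] = refl
dot-zeroʳ (x ∷ w) = trans (cong (_xor dot w zeros) (∧-zeroʳ x)) (dot-zeroʳ w)

dot-comm : ∀ {n} (u w : Vec₂ n) → dot u w ≡ dot w u
dot-comm [] [] = refl
dot-comm (x ∷ u) (y ∷ w) = cong₂ _xor_ (∧-comm x y) (dot-comm u w)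

dot-distribʳ-⊕v : ∀ {n} (u v w : Vec₂ n) → dot (u ⊕v v) w ≡ dot u w xor dot v w
dot-distribʳ-⊕v [] [] [] = refl
dot-distribʳ-⊕v (x ∷ u) (y ∷ v) (z ∷ w) =
  trans (cong₂ _xor_ (∧-distribʳ-xor z x y) (dot-distribʳ-⊕v u v w))
        (Xor.+-interchange (x ∧ z) (y ∧ z) (dot u w) (dot v w))

dot-distribˡ-⊕v : ∀ {n} (u v w : Vec₂ n) → dot w (u ⊕v v) ≡ dot w u xor dot w v
dot-distribˡ-⊕v u v w =
  trans (dot-comm w _) (trans (dot-distribʳ-⊕v u v w) (cong₂ _xor_ (dot-comm u w) (dot-comm v w)))

dot-·vˡ : ∀ {n} c (r w : Vec₂ n) → dot (c ·v r) w ≡ c ∧ dot r w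
dot-·vˡ true r w = refl
dot-·vˡ false r w = dot-zeroˡ w

unit : ∀ {n} → Fin n → Vec₂ n
unit zero = true ∷ zeros
unit (suc i) = false ∷ unit i

dot-unitˡ : ∀ {n} (i : Fin n) (w : Vec₂ n) → dot (unit i) w ≡ lookup w i
dot-unitˡ zero (x ∷ w) = trans (cong (x xor_) (dot-zeroˡ w)) (xor-identityʳ x)
dot-unitˡ (suc i) (x ∷ w) = dot-unitˡ i w

dot-unitʳ : ∀ {n} (i : Fin n) (w : Vec₂ n) → dot w (unit i) ≡ lookup w i
dot-unitʳ i w = trans (dot-comm w (unit i)) (dot-unitˡ i w)

dot-ext : ∀ {n} (u v : Vec₂ n) → (∀ x → dot x u ≡ dot x v) → u ≡ v
dot-ext [] [] h = refl
dot-ext (a ∷ u) (b ∷ v) h =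
  cong₂ _∷_ (trans (sym (dot-unitˡ zero (a ∷ u))) (trans (h (unit zero)) (dot-unitˡ zero (b ∷ v))))
            (dot-ext u v (λ x → h (false ∷ x)))

isZero : ∀ {n} → Vec₂ n → Bool
isZero [] = true
isZero (x ∷ u) = not x ∧ isZero u

isZero-zeros : ∀ n → isZero (zeros {n}) ≡ true
isZero-zeros zero = refl
isZero-zeros (suc n) = isZero-zeros n

isZero⇒≡zeros : ∀ {n} (u : Vec₂ n) → isZero u ≡ true → u ≡ zeros
isZero⇒≡zeros [] e = refl
isZero⇒≡zeros (false ∷ u) e = cong (false ∷_) (isZero⇒≡zeros u e)

¬isZero⇒≢zeros : ∀ {n} (u : Vec₂ n) → isZero u ≡ false → ¬ (u ≡ zeros)
¬isZero⇒≢zeros {n} u e refl with trans (sym e) (isZero-zeros n)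
... | ()

nonzero-coordinate : ∀ {n} (u : Vec₂ n) → isZero u ≡ false → Σ (Fin n) λ i → lookup u i ≡ true
nonzero-coordinate (true ∷ u) e = zero , refl
nonzero-coordinate (false ∷ u) e with nonzero-coordinate u e
... | i , p = suc i , p

vecMat-zeroˡ : ∀ {m n} (M : Vec (Vec₂ n) m) → vecMat zeros M ≡ zeros
vecMat-zeroˡ [] = refl
vecMat-zeroˡ (r ∷ M) = trans (⊕v-identityˡ _) (vecMat-zeroˡ M)

vecMat-zeroʳ : ∀ {m n} (c : Vec₂ m) → vecMat c (replicate m (zeros {n})) ≡ zeros
vecMat-zeroʳ [] = refl
vecMat-zeroʳ (x ∷ c) = trans (cong₂ _⊕v_ (·v-zeroʳ x) (vecMat-zeroʳ c)) (⊕v-identityˡ zeros)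

vecMat-·v : ∀ {m n} c (r : Vec₂ m) (M : Vec (Vec₂ n) m) → vecMat (c ·v r) M ≡ c ·v vecMat r M
vecMat-·v true r M = refl
vecMat-·v false r M = vecMat-zeroˡ M

vecMat-distribʳ-⊕v : ∀ {m n} (a b : Vec₂ m) (M : Vec (Vec₂ n) m) →
  vecMat (a ⊕v b) M ≡ vecMat a M ⊕v vecMat b M
vecMat-distribʳ-⊕v [] [] [] = sym (⊕v-identityˡ zeros)
vecMat-distribʳ-⊕v (x ∷ a) (y ∷ b) (r ∷ M) =
  trans (cong₂ _⊕v_ (·v-distribʳ-xor x y r) (vecMat-distribʳ-⊕v a b M))
        (⊕v.+-interchange (x ·v r) (y ·v r) (vecMat a M) (vecMat b M))

vecMat-unit : ∀ {m n} (i : Fin m) (M : Vec (Vec₂ n) m) → vecMat (unit i) M ≡ lookup M i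
vecMat-unit zero (r ∷ M) = trans (cong (r ⊕v_) (vecMat-zeroˡ M)) (⊕v.+-identityʳ r)
vecMat-unit (suc i) (r ∷ M) = trans (⊕v-identityˡ _) (vecMat-unit i M)

vecMat-ext : ∀ {m n} (M N : Vec (Vec₂ n) m) → (∀ x → vecMat x M ≡ vecMat x N) → M ≡ N
vecMat-ext [] [] h = refl
vecMat-ext (r ∷ M) (s ∷ N) h =
  cong₂ _∷_ (trans (sym (vecMat-unit zero (r ∷ M))) (trans (h (unit zero)) (vecMat-unit zero (s ∷ N))))
            (vecMat-ext M N (λ x → trans (sym (⊕v-identityˡ _)) (trans (h (false ∷ x)) (⊕v-identityˡ _))))

vecMat-false∷ : ∀ {m n} (a : Vec₂ m) (M : Vec (Vec₂ n) m) →
  vecMat a (map (false ∷_) M) ≡ false ∷ vecMat a M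
vecMat-false∷ [] [] = refl
vecMat-false∷ (true ∷ a) (r ∷ M) = cong ((false ∷ r) ⊕v_) (vecMat-false∷ a M)
vecMat-false∷ (false ∷ a) (r ∷ M) = cong (zeros ⊕v_) (vecMat-false∷ a M)

idMat-suc : ∀ {n} → idMat {suc n} ≡ unit zero ∷ map (false ∷_) idMat
idMat-suc {n} = cong₂ _∷_ (cong (true ∷_) (tabulate-false n))
                          (tabulate-∘ (false ∷_) (λ i → tabulate (λ j → does (i ≟ j))))
  where
  tabulate-false : ∀ k → tabulate {n = k} (λ _ → false) ≡ zeros
  tabulate-false zero = refl
  tabulate-false (suc k) = cong (false ∷_) (tabulate-false k)

vecMat-identity : ∀ {n} (a : Vec₂ n) → vecMat a idMat ≡ a
vecMat-identity [] = refl
vecMat-identity (x ∷ a) =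
  trans (cong (vecMat (x ∷ a)) idMat-suc)
        (trans (cong (x ·v unit zero ⊕v_) (trans (vecMat-false∷ a idMat) (cong (false ∷_) (vecMat-identity a))))
               (head-unit x))
  where
  head-unit : ∀ x → x ·v unit zero ⊕v (false ∷ a) ≡ x ∷ a
  head-unit true = cong (true ∷_) (⊕v-identityˡ a)
  head-unit false = cong (false ∷_) (⊕v-identityˡ a)

vecMat-assoc : ∀ {m n k} (a : Vec₂ m) (M : Vec (Vec₂ n) m) (N : Vec (Vec₂ k) n) →
  vecMat (vecMat a M) N ≡ vecMat a (map (λ r → vecMat r N) M)
vecMat-assoc [] [] N = vecMat-zeroˡ N
vecMat-assoc (x ∷ a) (r ∷ M) N =
  trans (vecMat-distribʳ-⊕v (x ·v r) (vecMat a M) N) (cong₂ _⊕v_ (vecMat-·v x r N) (vecMat-assoc a M N))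

vecMat-·m : ∀ {n} (x : Vec₂ n) (M N : Mat n) → vecMat x (M ·m N) ≡ vecMat (vecMat x M) N
vecMat-·m x M N = sym (vecMat-assoc x M N)

vecMat-inverse : ∀ {n} {A A' : Mat n} → A ·m A' ≡ idMat → ∀ x → vecMat (vecMat x A) A' ≡ x
vecMat-inverse {A = A} {A'} AA' x = trans (sym (vecMat-·m x A A')) (trans (cong (vecMat x) AA') (vecMat-identity x))

vecMat-transpose : ∀ {m n} (y : Vec₂ n) (M : Vec (Vec₂ n) m) → vecMat y (transpose M) ≡ map (λ r → dot r y) M
vecMat-transpose y [] = vecMat-zeroʳ y
vecMat-transpose y (r ∷ M) =
  trans (cong (vecMat y) (sym (zipWith-is-⊛ _∷_ r (transpose M))))
  (trans (vecMat-zipWith y r (transpose M)) (cong₂ _∷_ (dot-comm y r) (vecMat-transpose y M)))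
  where
  vecMat-zipWith : ∀ {m n} (y r : Vec₂ n) (T : Vec (Vec₂ m) n) → vecMat y (zipWith _∷_ r T) ≡ dot y r ∷ vecMat y T
  vecMat-zipWith [] [] [] = refl
  vecMat-zipWith (true ∷ y) (r ∷ rs) (t ∷ T) = cong ((r ∷ t) ⊕v_) (vecMat-zipWith y rs T)
  vecMat-zipWith (false ∷ y) (r ∷ rs) (t ∷ T) = cong (zeros ⊕v_) (vecMat-zipWith y rs T)

dot-vecMat : ∀ {m n} (a : Vec₂ m) (M : Vec (Vec₂ n) m) (y : Vec₂ n) →
  dot (vecMat a M) y ≡ dot a (vecMat y (transpose M))
dot-vecMat a M y = trans (adjoint a M) (cong (dot a) (sym (vecMat-transpose y M)))
  where
  adjoint : ∀ {m} (a : Vec₂ m) M → dot (vecMat a M) y ≡ dot a (map (λ r → dot r y) M)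
  adjoint [] [] = dot-zeroˡ y
  adjoint (x ∷ a) (r ∷ M) =
    trans (dot-distribʳ-⊕v (x ·v r) (vecMat a M) y) (cong₂ _xor_ (dot-·vˡ x r y) (adjoint a M))

additive⇒matrix : ∀ {m k} (F : Vec₂ m → Vec₂ k) → (∀ u v → F (u ⊕v v) ≡ F u ⊕v F v) →
  Σ (Vec (Vec₂ k) m) λ M → ∀ a → F a ≡ vecMat a M
additive⇒matrix {zero} F additive =
  [] , λ { [] → trans (cong F (sym (⊕v-self []))) (trans (additive [] []) (⊕v-self (F []))) }
additive⇒matrix {suc m} F additive = F (unit zero) ∷ M , λ { (x ∷ a) → begin
    F (x ∷ a)                           ≡⟨ cong F (sym (cong₂ _∷_ (xor-identityʳ x) (⊕v-identityˡ a))) ⟩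
    F ((x ∷ zeros) ⊕v (false ∷ a))      ≡⟨ additive (x ∷ zeros) (false ∷ a) ⟩
    F (x ∷ zeros) ⊕v F (false ∷ a)      ≡⟨ cong₂ _⊕v_ (head x) (F-tail a) ⟩
    x ·v F (unit zero) ⊕v vecMat a M    ∎ }
  where
  open ≡-Reasoning
  tail-rep = additive⇒matrix (λ a → F (false ∷ a)) (λ u v → additive (false ∷ u) (false ∷ v))
  M = proj₁ tail-rep
  F-tail = proj₂ tail-rep
  head : ∀ x → F (x ∷ zeros) ≡ x ·v F (unit zero)
  head true = refl
  head false = trans (cong F (sym (⊕v-self zeros))) (trans (additive zeros zeros) (⊕v-self _))

additive⇒dot : ∀ {m} (g : Vec₂ m → Bool) → (∀ u v → g (u ⊕v v) ≡ g u xor g v) →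
  Σ (Vec₂ m) λ w → ∀ a → g a ≡ dot a w
additive⇒dot {zero} g additive =
  [] , λ { [] → trans (cong g (sym (⊕v-self []))) (trans (additive [] []) (xor-same (g []))) }
additive⇒dot {suc m} g additive = g (unit zero) ∷ w , λ { (x ∷ a) → begin
    g (x ∷ a)                        ≡⟨ cong g (sym (cong₂ _∷_ (xor-identityʳ x) (⊕v-identityˡ a))) ⟩
    g ((x ∷ zeros) ⊕v (false ∷ a))   ≡⟨ additive (x ∷ zeros) (false ∷ a) ⟩
    g (x ∷ zeros) xor g (false ∷ a)  ≡⟨ cong₂ _xor_ (head x) (g-tail a) ⟩
    (x ∧ g (unit zero)) xor dot a w  ∎ }
  where
  open ≡-Reasoning
  tail-rep = additive⇒dot (λ a → g (false ∷ a)) (λ u v → additive (false ∷ u) (false ∷ v))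
  w = proj₁ tail-rep
  g-tail = proj₂ tail-rep
  head : ∀ x → g (x ∷ zeros) ≡ x ∧ g (unit zero)
  head true = refl
  head false = trans (cong g (sym (⊕v-self zeros))) (trans (additive zeros zeros) (xor-same (g zeros)))

outer : ∀ {m n} → Vec₂ m → Vec₂ n → Vec (Vec₂ n) m
outer p q = map (_·v q) p

vecMat-outer : ∀ {m n} (x p : Vec₂ m) (q : Vec₂ n) → vecMat x (outer p q) ≡ dot x p ·v q
vecMat-outer [] [] q = refl
vecMat-outer (x ∷ xs) (p ∷ ps) q =
  trans (cong₂ _⊕v_ (·v-∧ x p) (vecMat-outer xs ps q)) (sym (·v-distribʳ-xor (x ∧ p) (dot xs ps) q))
  where
  ·v-∧ : ∀ x p → x ·v (p ·v q) ≡ (x ∧ p) ·v q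
  ·v-∧ true p = refl
  ·v-∧ false p = refl

_+M_ : ∀ {m n} → Vec (Vec₂ n) m → Vec (Vec₂ n) m → Vec (Vec₂ n) m
_+M_ = zipWith _⊕v_

vecMat-+M : ∀ {m n} (x : Vec₂ m) (M N : Vec (Vec₂ n) m) → vecMat x (M +M N) ≡ vecMat x M ⊕v vecMat x N
vecMat-+M [] [] [] = sym (⊕v-identityˡ zeros)
vecMat-+M (x ∷ xs) (r ∷ M) (s ∷ N) =
  trans (cong₂ _⊕v_ (·v-distribˡ-⊕v x r s) (vecMat-+M xs M N))
        (⊕v.+-interchange (x ·v r) (x ·v s) (vecMat xs M) (vecMat xs N))

transvection : ∀ {n} → Vec₂ n → Vec₂ n → Mat n
transvection z w = idMat +M outer z w

vecMat-transvection : ∀ {n} (x z w : Vec₂ n) → vecMat x (transvection z w) ≡ x ⊕v dot x z ·v w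
vecMat-transvection x z w =
  trans (vecMat-+M x idMat (outer z w)) (cong₂ _⊕v_ (vecMat-identity x) (vecMat-outer x z w))

transvection-involutive : ∀ {n} {z w : Vec₂ n} → dot w z ≡ false →
  IsInvPair (transvection z w) (transvection z w)
transvection-involutive {z = z} {w} wz = T·T≡I , T·T≡I
  where
  T = transvection z w
  twice : ∀ x → vecMat (vecMat x T) T ≡ x
  twice x = begin
    vecMat (vecMat x T) T                         ≡⟨ vecMat-transvection _ z w ⟩
    vecMat x T ⊕v dot (vecMat x T) z ·v w         ≡⟨ cong (λ y → y ⊕v dot y z ·v w) (vecMat-transvection x z w) ⟩
    (x ⊕v c ·v w) ⊕v dot (x ⊕v c ·v w) z ·v w     ≡⟨ cong (λ b → (x ⊕v c ·v w) ⊕v b ·v w) y·z≡c ⟩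
    (x ⊕v c ·v w) ⊕v c ·v w                       ≡⟨ ⊕v.[x+y]+y≡x x (c ·v w) ⟩
    x                                             ∎
    where
    open ≡-Reasoning
    c = dot x z
    y·z≡c : dot (x ⊕v c ·v w) z ≡ c
    y·z≡c = trans (dot-distribʳ-⊕v x (c ·v w) z)
      (trans (cong (c xor_) (trans (dot-·vˡ c w z) (trans (cong (c ∧_) wz) (∧-zeroʳ c)))) (xor-identityʳ c))
  T·T≡I : T ·m T ≡ idMat
  T·T≡I = vecMat-ext _ _ λ x → trans (vecMat-·m x T T) (trans (twice x) (sym (vecMat-identity x)))

common-non-orthogonal : ∀ {n} (p q : Vec₂ n) → isZero p ≡ false → isZero q ≡ false →
  Σ (Vec₂ n) λ w → (dot w p ≡ true) × (dot w q ≡ true)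
common-non-orthogonal p q p≢0 q≢0 with nonzero-coordinate p p≢0 | nonzero-coordinate q q≢0
... | i , pᵢ | j , qⱼ with lookup q i in qᵢ | lookup p j in pⱼ
... | true | _ = unit i , trans (dot-unitˡ i p) pᵢ , trans (dot-unitˡ i q) qᵢ
... | false | true = unit j , trans (dot-unitˡ j p) pⱼ , trans (dot-unitˡ j q) qⱼ
... | false | false =
  unit i ⊕v unit j ,
  trans (dot-distribʳ-⊕v (unit i) (unit j) p) (cong₂ _xor_ (trans (dot-unitˡ i p) pᵢ) (trans (dot-unitˡ j p) pⱼ)) ,
  trans (dot-distribʳ-⊕v (unit i) (unit j) q) (cong₂ _xor_ (trans (dot-unitˡ i q) qᵢ) (trans (dot-unitˡ j q) qⱼ))

-- T : x ↦ x + (x · (p + q)) w with w · p = w · q = 1.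
transvection-between : ∀ {n} (p q : Vec₂ n) → isZero p ≡ false → isZero q ≡ false →
  Σ (Mat n) λ T → IsInvPair T T × (∀ x → dot (vecMat x T) p ≡ dot x q)
transvection-between p q p≢0 q≢0 with common-non-orthogonal p q p≢0 q≢0
... | w , w·p , w·q = transvection z w , transvection-involutive w·z , moves
  where
  z = p ⊕v q
  w·z : dot w z ≡ false
  w·z = trans (dot-distribˡ-⊕v p q w) (cong₂ _xor_ w·p w·q)
  moves : ∀ x → dot (vecMat x (transvection z w)) p ≡ dot x q
  moves x = begin
    dot (vecMat x (transvection z w)) p   ≡⟨ cong (λ v → dot v p) (vecMat-transvection x z w) ⟩
    dot (x ⊕v dot x z ·v w) p             ≡⟨ dot-distribʳ-⊕v x _ p ⟩
    dot x p xor dot (dot x z ·v w) p      ≡⟨ cong (dot x p xor_) (dot-·vˡ (dot x z) w p) ⟩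
    dot x p xor (dot x z ∧ dot w p)       ≡⟨ cong (λ b → dot x p xor (dot x z ∧ b)) w·p ⟩
    dot x p xor (dot x z ∧ true)          ≡⟨ cong (dot x p xor_) (trans (∧-identityʳ _) (dot-distribˡ-⊕v p q x)) ⟩
    dot x p xor (dot x p xor dot x q)     ≡⟨ Xor.x+[x+y]≡y (dot x p) (dot x q) ⟩
    dot x q                               ∎
    where open ≡-Reasoning

symmetric-of-self-adjoint : ∀ {n} (Q : Mat n) → (∀ x y → dot (vecMat y Q) x ≡ dot y (vecMat x Q)) → transpose Q ≡ Q
symmetric-of-self-adjoint Q self-adjoint =
  vecMat-ext _ _ λ x → dot-ext _ _ λ y → trans (sym (dot-vecMat y Q x)) (self-adjoint x y)

symOuter : ∀ {n} → Vec₂ n → Vec₂ n → Mat n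
symOuter u s = outer u s +M outer s u

dot-symOuter : ∀ {n} (c u s y : Vec₂ n) → dot (vecMat c (symOuter u s)) y ≡ (dot c u ∧ dot s y) xor (dot c s ∧ dot u y)
dot-symOuter c u s y =
  trans (cong (λ v → dot v y) (trans (vecMat-+M c (outer u s) (outer s u)) (cong₂ _⊕v_ (vecMat-outer c u s) (vecMat-outer c s u))))
        (trans (dot-distribʳ-⊕v (dot c u ·v s) (dot c s ·v u) y) (cong₂ _xor_ (dot-·vˡ (dot c u) s y) (dot-·vˡ (dot c s) u y)))

symOuter-symmetric : ∀ {n} (u s : Vec₂ n) → transpose (symOuter u s) ≡ symOuter u s
symOuter-symmetric u s = symmetric-of-self-adjoint (symOuter u s) λ x y → begin
  dot (vecMat y (symOuter u s)) x
    ≡⟨ dot-symOuter y u s x ⟩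
  (dot y u ∧ dot s x) xor (dot y s ∧ dot u x)
    ≡⟨ solve 4 (λ a b c d → (a :* b) :+ (c :* d) := (d :* c) :+ (b :* a)) refl
                                                              (dot y u) (dot s x) (dot y s) (dot u x) ⟩
  (dot u x ∧ dot y s) xor (dot s x ∧ dot y u)
    ≡⟨ cong₂ (λ d c → (d ∧ c) xor (dot s x ∧ dot y u)) (dot-comm u x) (dot-comm y s) ⟩
  (dot x u ∧ dot s y) xor (dot s x ∧ dot y u)
    ≡⟨ cong₂ (λ b a → (dot x u ∧ dot s y) xor (b ∧ a)) (dot-comm s x) (dot-comm y u) ⟩
  (dot x u ∧ dot s y) xor (dot x s ∧ dot u y)
    ≡⟨ sym (dot-symOuter x u s y) ⟩
  dot (vecMat x (symOuter u s)) y
    ≡⟨ dot-comm _ y ⟩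
  dot y (vecMat x (symOuter u s))   ∎
  where open ≡-Reasoning

symOuter-alternating : ∀ {n} (u s b : Vec₂ n) → dot (vecMat b (symOuter u s)) b ≡ false
symOuter-alternating u s b = begin
  dot (vecMat b (symOuter u s)) b
    ≡⟨ dot-symOuter b u s b ⟩
  (dot b u ∧ dot s b) xor (dot b s ∧ dot u b)
    ≡⟨ cong₂ (λ x y → (dot b u ∧ x) xor (dot b s ∧ y)) (dot-comm s b) (dot-comm u b) ⟩
  (dot b u ∧ dot b s) xor (dot b s ∧ dot b u)
    ≡⟨ solve 2 (λ a c → (a :* c) :+ (c :* a) := con false) refl (dot b u) (dot b s) ⟩
  false   ∎
  where open ≡-Reasoning

⊕-assoc : ∀ {n} (u v w : V n) → (u ⊕ v) ⊕ w ≡ u ⊕ (v ⊕ w)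
⊕-assoc (a , b) (c , d) (e , f) = cong₂ _,_ (⊕v-assoc a c e) (⊕v-assoc b d f)

⊕-comm : ∀ {n} (u v : V n) → u ⊕ v ≡ v ⊕ u
⊕-comm (a , b) (c , d) = cong₂ _,_ (⊕v-comm a c) (⊕v-comm b d)

⊕-identityˡ : ∀ {n} (u : V n) → zeroV ⊕ u ≡ u
⊕-identityˡ (a , b) = cong₂ _,_ (⊕v-identityˡ a) (⊕v-identityˡ b)

⊕-self : ∀ {n} (u : V n) → u ⊕ u ≡ zeroV
⊕-self (a , b) = cong₂ _,_ (⊕v-self a) (⊕v-self b)

module ⊕ {n} = ExponentTwo (_⊕_ {n}) zeroV ⊕-assoc ⊕-comm ⊕-identityˡ ⊕-self

B-distribʳ-⊕ : ∀ {n} (x y z : V n) → B (x ⊕ y) z ≡ B x z xor B y z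
B-distribʳ-⊕ (a , b) (a' , b') (c , d) =
  trans (cong₂ _xor_ (dot-distribʳ-⊕v a a' d) (dot-distribʳ-⊕v b b' c))
        (Xor.+-interchange (dot a d) (dot a' d) (dot b c) (dot b' c))

B-comm : ∀ {n} (x y : V n) → B x y ≡ B y x
B-comm (a , b) (c , d) = trans (cong₂ _xor_ (dot-comm a d) (dot-comm b c)) (xor-comm (dot d a) (dot c b))

B-distribˡ-⊕ : ∀ {n} (x y z : V n) → B z (x ⊕ y) ≡ B z x xor B z y
B-distribˡ-⊕ x y z = trans (B-comm z _) (trans (B-distribʳ-⊕ x y z) (cong₂ _xor_ (B-comm x z) (B-comm y z)))

B-zeroˡ : ∀ {n} (x : V n) → B zeroV x ≡ false
B-zeroˡ (c , d) = cong₂ _xor_ (dot-zeroˡ d) (dot-zeroˡ c)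

B-zeroʳ : ∀ {n} (x : V n) → B x zeroV ≡ false
B-zeroʳ x = trans (B-comm x zeroV) (B-zeroˡ x)

B-U : ∀ {n} (a : Vec₂ n) (y : V n) → B (a , zeros) y ≡ dot a (proj₂ y)
B-U a (y₁ , y₂) = trans (cong (dot a y₂ xor_) (dot-zeroˡ y₁)) (xor-identityʳ _)

B-on-U : ∀ {n} (v x : V n) → InU x → B v x ≡ dot (proj₁ x) (proj₂ v)
B-on-U v (x₁ , x₂) refl = trans (B-comm v (x₁ , zeros)) (B-U x₁ v)

B-ext : ∀ {n} (u v : V n) → (∀ x → B x u ≡ B x v) → u ≡ v
B-ext (u₁ , u₂) (v₁ , v₂) h = cong₂ _,_
  (dot-ext u₁ v₁ λ b → trans (sym (cong (_xor dot b u₁) (dot-zeroˡ u₂)))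
                              (trans (h (zeros , b)) (cong (_xor dot b v₁) (dot-zeroˡ v₂))))
  (dot-ext u₂ v₂ λ a → trans (sym (B-U a (u₁ , u₂))) (trans (h (a , zeros)) (B-U a (v₁ , v₂))))

U-totallyIsotropic : ∀ {n} (x y : V n) → InU x → InU y → B x y ≡ false
U-totallyIsotropic (x₁ , _) (y₁ , _) refl refl = cong₂ _xor_ (dot-zeroʳ x₁) (dot-zeroˡ y₁)

lin-zip : ∀ {n k} (c : Vec₂ k) (xs ys : Vec (Vec₂ n) k) →
  lin c (zipWith _,_ xs ys) ≡ (vecMat c xs , vecMat c ys)
lin-zip [] [] [] = refl
lin-zip (true ∷ c) (x ∷ xs) (y ∷ ys) = cong ((x , y) ⊕_) (lin-zip c xs ys)
lin-zip (false ∷ c) (x ∷ xs) (y ∷ ys) = cong (zeroV ⊕_) (lin-zip c xs ys)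

lin-zeros : ∀ {n k} (ws : Vec (V n) k) → lin zeros ws ≡ zeroV
lin-zeros [] = refl
lin-zeros (w ∷ ws) = trans (⊕-identityˡ _) (lin-zeros ws)

lin-distrib-⊕v : ∀ {n k} (c c' : Vec₂ k) (ws : Vec (V n) k) → lin (c ⊕v c') ws ≡ lin c ws ⊕ lin c' ws
lin-distrib-⊕v [] [] [] = sym (⊕-self zeroV)
lin-distrib-⊕v (x ∷ c) (y ∷ c') (w ∷ ws) =
  trans (cong₂ _⊕_ (if-xor x y) (lin-distrib-⊕v c c' ws)) (⊕.+-interchange _ _ (lin c ws) (lin c' ws))
  where
  if-xor : ∀ x y → (if x xor y then w else zeroV) ≡ (if x then w else zeroV) ⊕ (if y then w else zeroV)
  if-xor true true = sym (⊕-self w)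
  if-xor true false = sym (⊕.+-identityʳ w)
  if-xor false y = sym (⊕-identityˡ _)

Additive : ∀ {n} → (V n → V n) → Set
Additive f = ∀ u v → f (u ⊕ v) ≡ f u ⊕ f v

additive-zero : ∀ {n} (f : V n → V n) → Additive f → f zeroV ≡ zeroV
additive-zero f additive = trans (cong f (sym (⊕-self zeroV))) (trans (additive zeroV zeroV) (⊕-self (f zeroV)))

lin-map : ∀ {n k} (f : V n → V n) → Additive f → (c : Vec Bool k) (ws : Vec (V n) k) →
  lin c (map f ws) ≡ f (lin c ws)
lin-map f additive [] [] = sym (additive-zero f additive)
lin-map f additive (true ∷ c) (w ∷ ws) = trans (cong (f w ⊕_) (lin-map f additive c ws)) (sym (additive _ _))
lin-map f additive (false ∷ c) (w ∷ ws) =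
  trans (cong₂ _⊕_ (sym (additive-zero f additive)) (lin-map f additive c ws)) (sym (additive _ _))

independent-injective : ∀ {n k} (ws : Vec (V n) k) → Independent ws → ∀ c c' → lin c ws ≡ lin c' ws → c ≡ c'
independent-injective ws independent c c' e = ⊕v.x+y≡0⇒x≡y c c'
  (independent (c ⊕v c') (trans (lin-distrib-⊕v c c' ws) (trans (cong (_⊕ lin c' ws) e) (⊕-self _))))

independent-map : ∀ {n k} (f : V n → V n) → Additive f → (∀ x → f x ≡ zeroV → x ≡ zeroV) →
  (ws : Vec (V n) k) → Independent ws → Independent (map f ws)
independent-map f additive ker-f ws independent c e =
  independent c (ker-f _ (trans (sym (lin-map f additive c ws)) e))

inv-additive : ∀ {n} (g : Isom n) → Additive (inv g)
inv-additive g u v = begin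
  inv g (u ⊕ v)                            ≡⟨ cong (inv g) (cong₂ _⊕_ (sym (fun-inv g u)) (sym (fun-inv g v))) ⟩
  inv g (fun g (inv g u) ⊕ fun g (inv g v)) ≡⟨ cong (inv g) (sym (additive g (inv g u) (inv g v))) ⟩
  inv g (fun g (inv g u ⊕ inv g v))        ≡⟨ inv-fun g _ ⟩
  inv g u ⊕ inv g v                        ∎
  where open ≡-Reasoning

invIsom : ∀ {n} → Isom n → Isom n
invIsom g = record
  { fun = inv g ; inv = fun g ; inv-fun = fun-inv g ; fun-inv = inv-fun g ; additive = inv-additive g
  ; isometry = λ u v → trans (sym (isometry g (inv g u) (inv g v))) (cong₂ B (fun-inv g u) (fun-inv g v)) }

idIsom : ∀ {n} → Isom n
idIsom = record { fun = λ x → x ; inv = λ x → x ; inv-fun = λ _ → refl ; fun-inv = λ _ → refl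
                ; additive = λ _ _ → refl ; isometry = λ _ _ → refl }

compIsom : ∀ {n} → Isom n → Isom n → Isom n
compIsom g h = record
  { fun = λ x → fun h (fun g x) ; inv = λ x → inv g (inv h x)
  ; inv-fun = λ v → trans (cong (inv g) (inv-fun h (fun g v))) (inv-fun g v)
  ; fun-inv = λ v → trans (cong (fun h) (fun-inv g (inv h v))) (fun-inv h v)
  ; additive = λ u v → trans (cong (fun h) (additive g u v)) (additive h _ _)
  ; isometry = λ u v → trans (isometry h _ _) (isometry g u v) }

fun-kernel : ∀ {n} (g : Isom n) → ∀ x → fun g x ≡ zeroV → x ≡ zeroV
fun-kernel g x e = trans (sym (inv-fun g x)) (trans (cong (inv g) e) (additive-zero (inv g) (inv-additive g)))

module _ {n} {A A' : Mat n} (AA'≡I : A ·m A' ≡ idMat) where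

  dot-Lmap : ∀ (a d : Vec₂ n) → dot (vecMat a A) (vecMat d (transpose A')) ≡ dot a d
  dot-Lmap a d = trans (sym (dot-vecMat (vecMat a A) A' d)) (cong (λ v → dot v d) (vecMat-inverse AA'≡I a))

  vecMat-transpose-inverse : ∀ (b : Vec₂ n) → vecMat (vecMat b (transpose A')) (transpose A) ≡ b
  vecMat-transpose-inverse b = dot-ext _ _ λ y → trans (sym (dot-vecMat y A _)) (dot-Lmap y b)

  Lmap-inverse : ∀ x → Lmap A' A (Lmap A A' x) ≡ x
  Lmap-inverse (a , b) = cong₂ _,_ (vecMat-inverse AA'≡I a) (vecMat-transpose-inverse b)

  Lmap-isometry : ∀ x y → B (Lmap A A' x) (Lmap A A' y) ≡ B x y
  Lmap-isometry (a , b) (c , d) = cong₂ _xor_ (dot-Lmap a d)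
    (trans (dot-comm (vecMat b (transpose A')) (vecMat c A)) (trans (dot-Lmap c b) (dot-comm c b)))

  Lmap-U : ∀ x → InU x ⇔ InU (Lmap A A' x)
  Lmap-U (a , b) = mk⇔ (λ { refl → vecMat-zeroˡ (transpose A') })
    (λ e → trans (sym (vecMat-transpose-inverse b)) (trans (cong (λ z → vecMat z (transpose A)) e) (vecMat-zeroˡ (transpose A))))

Lmap-additive : ∀ {n} (A A' : Mat n) → Additive (Lmap A A')
Lmap-additive A A' (a , b) (c , d) = cong₂ _,_ (vecMat-distribʳ-⊕v a c A) (vecMat-distribʳ-⊕v b d (transpose A'))

LIsom : ∀ {n} {A A' : Mat n} → IsInvPair A A' → Isom n
LIsom {A = A} {A'} (AA'≡I , A'A≡I) = record
  { fun = Lmap A A' ; inv = Lmap A' A ; inv-fun = Lmap-inverse AA'≡I ; fun-inv = Lmap-inverse A'A≡I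
  ; additive = Lmap-additive A A' ; isometry = Lmap-isometry AA'≡I }

Rmap-isometry : ∀ {n} {Q : Mat n} → transpose Q ≡ Q → ∀ x y → B (Rmap Q x) (Rmap Q y) ≡ B x y
Rmap-isometry {Q = Q} Qᵀ≡Q (a , b) (c , d) = begin
  dot (a ⊕v bQ) d xor dot b (c ⊕v dQ)
    ≡⟨ cong₂ _xor_ (dot-distribʳ-⊕v a bQ d) (dot-distribˡ-⊕v c dQ b) ⟩
  (dot a d xor dot bQ d) xor (dot b c xor dot b dQ)
    ≡⟨ Xor.+-interchange (dot a d) (dot bQ d) (dot b c) (dot b dQ) ⟩
  (dot a d xor dot b c) xor (dot bQ d xor dot b dQ)
    ≡⟨ cong (λ t → (dot a d xor dot b c) xor (t xor dot b dQ)) Q-symmetric ⟩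
  (dot a d xor dot b c) xor (dot b dQ xor dot b dQ)
    ≡⟨ cong ((dot a d xor dot b c) xor_) (xor-same (dot b dQ)) ⟩
  (dot a d xor dot b c) xor false
    ≡⟨ xor-identityʳ _ ⟩
  dot a d xor dot b c   ∎
  where
  open ≡-Reasoning
  bQ = vecMat b Q
  dQ = vecMat d Q
  Q-symmetric : dot bQ d ≡ dot b dQ
  Q-symmetric = trans (dot-vecMat b Q d) (cong (λ M → dot b (vecMat d M)) Qᵀ≡Q)

Rmap-involutive : ∀ {n} (Q : Mat n) x → Rmap Q (Rmap Q x) ≡ x
Rmap-involutive Q (a , b) = cong (_, b) (⊕v.[x+y]+y≡x a (vecMat b Q))

Rmap-additive : ∀ {n} (Q : Mat n) → Additive (Rmap Q)
Rmap-additive Q (a , b) (c , d) =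
  cong (_, b ⊕v d) (trans (cong ((a ⊕v c) ⊕v_) (vecMat-distribʳ-⊕v b d Q)) (⊕v.+-interchange a c _ _))

RIsom : ∀ {n} {Q : Mat n} → transpose Q ≡ Q → Isom n
RIsom {Q = Q} Qᵀ≡Q = record
  { fun = Rmap Q ; inv = Rmap Q ; inv-fun = Rmap-involutive Q ; fun-inv = Rmap-involutive Q
  ; additive = Rmap-additive Q ; isometry = Rmap-isometry Qᵀ≡Q }

φ₀ : ∀ {n} → Form n
φ₀ (a , b) = dot a b

φ₀-polarises : ∀ {n} → Polarises (φ₀ {n})
φ₀-polarises (a , b) (c , d) = begin
  dot a d xor dot b c
    ≡⟨ cong (dot a d xor_) (dot-comm b c) ⟩
  dot a d xor dot c b
    ≡⟨ solve 4 (λ ab ad cb cd → ad :+ cb := (((ab :+ ad) :+ (cb :+ cd)) :+ ab) :+ cd) refl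
               (dot a b) (dot a d) (dot c b) (dot c d) ⟩
  (((dot a b xor dot a d) xor (dot c b xor dot c d)) xor dot a b) xor dot c d
    ≡⟨ cong (λ t → (t xor dot a b) xor dot c d) (sym expand) ⟩
  (dot (a ⊕v c) (b ⊕v d) xor dot a b) xor dot c d   ∎
  where
  open ≡-Reasoning
  expand : dot (a ⊕v c) (b ⊕v d) ≡ (dot a b xor dot a d) xor (dot c b xor dot c d)
  expand = trans (dot-distribʳ-⊕v a c (b ⊕v d)) (cong₂ _xor_ (dot-distribˡ-⊕v b d a) (dot-distribˡ-⊕v b d c))

φ[_] : ∀ {n} → V n → Form n
φ[ p ] v = φ₀ v xor B v p

φ[]-polarises : ∀ {n} (p : V n) → Polarises φ[ p ]
φ[]-polarises p x y = begin
  B x y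
    ≡⟨ φ₀-polarises x y ⟩
  (φ₀ (x ⊕ y) xor φ₀ x) xor φ₀ y
    ≡⟨ solve 5 (λ P a b l₁ l₂ → (P :+ a) :+ b := ((P :+ (l₁ :+ l₂)) :+ (a :+ l₁)) :+ (b :+ l₂)) refl
               (φ₀ (x ⊕ y)) (φ₀ x) (φ₀ y) (B x p) (B y p) ⟩
  ((φ₀ (x ⊕ y) xor (B x p xor B y p)) xor φ[ p ] x) xor φ[ p ] y
    ≡⟨ cong (λ t → ((φ₀ (x ⊕ y) xor t) xor φ[ p ] x) xor φ[ p ] y) (sym (B-distribʳ-⊕ x y p)) ⟩
  (φ[ p ] (x ⊕ y) xor φ[ p ] x) xor φ[ p ] y   ∎
  where open ≡-Reasoning

polarises-⊕ : ∀ {n} (φ : Form n) → Polarises φ → ∀ x y → φ (x ⊕ y) ≡ (φ x xor φ y) xor B x y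
polarises-⊕ φ pol x y = begin
  φ (x ⊕ y)
    ≡⟨ solve 3 (λ s a b → s := ((s :+ a) :+ b) :+ (a :+ b)) refl (φ (x ⊕ y)) (φ x) (φ y) ⟩
  ((φ (x ⊕ y) xor φ x) xor φ y) xor (φ x xor φ y)
    ≡⟨ cong (_xor (φ x xor φ y)) (sym (pol x y)) ⟩
  B x y xor (φ x xor φ y)
    ≡⟨ xor-comm (B x y) _ ⟩
  (φ x xor φ y) xor B x y   ∎
  where open ≡-Reasoning

additive⇒B : ∀ {n} (f : V n → Bool) → (∀ u v → f (u ⊕ v) ≡ f u xor f v) → Σ (V n) λ p → ∀ v → f v ≡ B v p
additive⇒B f additive = (w₂ , w₁) , λ { (a , b) → begin
    f (a , b)                          ≡⟨ cong f (sym (cong₂ _,_ (⊕v.+-identityʳ a) (⊕v-identityˡ b))) ⟩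
    f ((a , zeros) ⊕ (zeros , b))      ≡⟨ additive (a , zeros) (zeros , b) ⟩
    f (a , zeros) xor f (zeros , b)    ≡⟨ cong₂ _xor_ (f₁-rep a) (f₂-rep b) ⟩
    dot a w₁ xor dot b w₂              ∎ }
  where
  open ≡-Reasoning
  f₁ = additive⇒dot (λ a → f (a , zeros))
         λ u v → trans (cong (λ z → f (u ⊕v v , z)) (sym (⊕v-self zeros))) (additive (u , zeros) (v , zeros))
  f₂ = additive⇒dot (λ b → f (zeros , b))
         λ u v → trans (cong (λ z → f (z , u ⊕v v)) (sym (⊕v-self zeros))) (additive (zeros , u) (zeros , v))
  w₁ = proj₁ f₁
  f₁-rep = proj₂ f₁
  w₂ = proj₁ f₂
  f₂-rep = proj₂ f₂

polarises⇒φ[] : ∀ {n} (φ : Form n) → Polarises φ → Σ (V n) λ p → φ ≗F φ[ p ]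
polarises⇒φ[] φ pol = p , λ v → trans (sym (Xor.x+[x+y]≡y (φ₀ v) (φ v)))
                                      (cong (φ₀ v xor_) (trans (xor-comm (φ₀ v) (φ v)) (p-rep v)))
  where
  difference-additive : ∀ x y → φ (x ⊕ y) xor φ₀ (x ⊕ y) ≡ (φ x xor φ₀ x) xor (φ y xor φ₀ y)
  difference-additive x y = begin
    φ (x ⊕ y) xor φ₀ (x ⊕ y)
      ≡⟨ cong₂ _xor_ (polarises-⊕ φ pol x y) (polarises-⊕ φ₀ φ₀-polarises x y) ⟩
    ((φ x xor φ y) xor B x y) xor ((φ₀ x xor φ₀ y) xor B x y)
      ≡⟨ solve 5 (λ a b a' b' β → ((a :+ b) :+ β) :+ ((a' :+ b') :+ β) := (a :+ a') :+ (b :+ b')) refl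
                 (φ x) (φ y) (φ₀ x) (φ₀ y) (B x y) ⟩
    (φ x xor φ₀ x) xor (φ y xor φ₀ y)   ∎
    where open ≡-Reasoning
  rep = additive⇒B (λ v → φ v xor φ₀ v) difference-additive
  p = proj₁ rep
  p-rep = proj₂ rep

polarises-zero : ∀ {n} (φ : Form n) → Polarises φ → φ zeroV ≡ false
polarises-zero {n} φ pol = begin
  φ 0V                             ≡⟨ cong φ (sym (⊕-self 0V)) ⟩
  φ (0V ⊕ 0V)                      ≡⟨ polarises-⊕ φ pol 0V 0V ⟩
  (φ 0V xor φ 0V) xor B 0V 0V      ≡⟨ cong₂ _xor_ (xor-same (φ 0V)) (B-zeroˡ 0V) ⟩
  false                            ∎
  where
  open ≡-Reasoning
  0V = zeroV {n}

φ[]-translate : ∀ {n} (p v : V n) → φ[ p ] v ≡ φ₀ (v ⊕ p) xor φ₀ p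
φ[]-translate p v = sym (begin
  φ₀ (v ⊕ p) xor φ₀ p
    ≡⟨ cong (_xor φ₀ p) (polarises-⊕ φ₀ φ₀-polarises v p) ⟩
  ((φ₀ v xor φ₀ p) xor B v p) xor φ₀ p
    ≡⟨ solve 3 (λ a b c → ((a :+ b) :+ c) :+ b := a :+ c) refl (φ₀ v) (φ₀ p) (B v p) ⟩
  φ₀ v xor B v p   ∎)
  where open ≡-Reasoning

φ[]-on-U : ∀ {n} (p : V n) (a : Vec₂ n) → φ[ p ] (a , zeros) ≡ dot a (proj₂ p)
φ[]-on-U (p₁ , p₂) a = trans (cong₂ _xor_ (dot-zeroʳ a) (cong (dot a p₂ xor_) (dot-zeroˡ p₁))) (xor-identityʳ _)

φ[]-injective : ∀ {n} {p q : V n} → φ[ p ] ≗F φ[ q ] → p ≡ q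
φ[]-injective {p = p} {q} h = B-ext p q λ x → Xor.+-cancelˡ-≡ (φ₀ x) (h x)

φ[]-isometry : ∀ {n} (g : Isom n) → (∀ y → φ₀ (fun g y) ≡ φ₀ y) → ∀ p y → φ[ p ] (fun g y) ≡ φ[ inv g p ] y
φ[]-isometry g φ₀-preserved p y =
  cong₂ _xor_ (φ₀-preserved y) (trans (cong (B (fun g y)) (sym (fun-inv g p))) (isometry g y (inv g p)))

QM-resp-≗ : ∀ {n} {φ ψ : Form n} → φ ≗F ψ → QM φ → QM ψ
QM-resp-≗ φ≗ψ (pol , (S , singular) , bound) =
  (λ x y → trans (pol x y) (cong₂ _xor_ (cong₂ _xor_ (φ≗ψ (x ⊕ _)) (φ≗ψ x)) (φ≗ψ y))) ,
  (S , λ x x∈S → trans (sym (φ≗ψ x)) (singular x x∈S)) ,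
  (λ m S' singular' → bound m S' (λ x x∈S' → trans (φ≗ψ x) (singular' x x∈S')))

-- Character sums and the Witt bound

module _ where
  open import Data.Integer using (ℤ; +_; -[1+_]; _+_; _*_; _≤_; _<_; 0ℤ; 1ℤ; -1ℤ; +≤+; +<+)
  import Data.Integer.Properties as ℤ
  open import Data.Integer.Tactic.RingSolver using (solve-∀)
  open import Algebra.Properties.CommutativeSemigroup ℤ.+-commutativeSemigroup using (interchange)

  ∑₂ : ∀ m → (Vec₂ m → ℤ) → ℤ
  ∑₂ zero f = f []
  ∑₂ (suc m) f = ∑₂ m (λ a → f (false ∷ a)) + ∑₂ m (λ a → f (true ∷ a))

  ∑V : ∀ n → (V n → ℤ) → ℤ
  ∑V n f = ∑₂ n (λ a → ∑₂ n (λ b → f (a , b)))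

  ∑₂-cong : ∀ m {f g : Vec₂ m → ℤ} → (∀ a → f a ≡ g a) → ∑₂ m f ≡ ∑₂ m g
  ∑₂-cong zero h = h []
  ∑₂-cong (suc m) h = cong₂ _+_ (∑₂-cong m (λ a → h (false ∷ a))) (∑₂-cong m (λ a → h (true ∷ a)))

  ∑V-cong : ∀ n {f g : V n → ℤ} → (∀ v → f v ≡ g v) → ∑V n f ≡ ∑V n g
  ∑V-cong n h = ∑₂-cong n λ a → ∑₂-cong n λ b → h (a , b)

  ∑₂-distrib-+ : ∀ m (f g : Vec₂ m → ℤ) → ∑₂ m (λ a → f a + g a) ≡ ∑₂ m f + ∑₂ m g
  ∑₂-distrib-+ zero f g = refl
  ∑₂-distrib-+ (suc m) f g =
    trans (cong₂ _+_ (∑₂-distrib-+ m (λ a → f (false ∷ a)) (λ a → g (false ∷ a)))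
                     (∑₂-distrib-+ m (λ a → f (true ∷ a)) (λ a → g (true ∷ a))))
          (interchange (∑₂ m (λ a → f (false ∷ a))) (∑₂ m (λ a → g (false ∷ a)))
                       (∑₂ m (λ a → f (true ∷ a))) (∑₂ m (λ a → g (true ∷ a))))

  ∑V-distrib-+ : ∀ n (f g : V n → ℤ) → ∑V n (λ v → f v + g v) ≡ ∑V n f + ∑V n g
  ∑V-distrib-+ n f g =
    trans (∑₂-cong n (λ a → ∑₂-distrib-+ n (λ b → f (a , b)) (λ b → g (a , b))))
          (∑₂-distrib-+ n (λ a → ∑₂ n (λ b → f (a , b))) (λ a → ∑₂ n (λ b → g (a , b))))

  ∑₂-*ˡ : ∀ m (k : ℤ) (f : Vec₂ m → ℤ) → ∑₂ m (λ a → k * f a) ≡ k * ∑₂ m f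
  ∑₂-*ˡ zero k f = refl
  ∑₂-*ˡ (suc m) k f = trans (cong₂ _+_ (∑₂-*ˡ m k _) (∑₂-*ˡ m k _)) (sym (ℤ.*-distribˡ-+ k _ _))

  ∑V-*ˡ : ∀ n (k : ℤ) (f : V n → ℤ) → ∑V n (λ v → k * f v) ≡ k * ∑V n f
  ∑V-*ˡ n k f = trans (∑₂-cong n (λ a → ∑₂-*ˡ n k _)) (∑₂-*ˡ n k _)

  two^ : ℕ → ℤ
  two^ m = + (2 ^ m)

  two^-suc : ∀ m → two^ (suc m) ≡ two^ m + two^ m
  two^-suc m = trans (cong (λ t → + (2 ^ m ℕ.+ t)) (ℕ.+-identityʳ (2 ^ m))) (ℤ.pos-+ (2 ^ m) (2 ^ m))

  ∑₂-const : ∀ m (k : ℤ) → ∑₂ m (λ _ → k) ≡ two^ m * k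
  ∑₂-const zero k = sym (ℤ.*-identityˡ k)
  ∑₂-const (suc m) k = trans (cong₂ _+_ (∑₂-const m k) (∑₂-const m k))
    (trans (sym (ℤ.*-distribʳ-+ k (two^ m) (two^ m))) (cong (_* k) (sym (two^-suc m))))

  ∑₂-swap : ∀ m k (F : Vec₂ m → Vec₂ k → ℤ) →
    ∑₂ m (λ a → ∑₂ k (λ c → F a c)) ≡ ∑₂ k (λ c → ∑₂ m (λ a → F a c))
  ∑₂-swap zero k F = refl
  ∑₂-swap (suc m) k F = trans (cong₂ _+_ (∑₂-swap m k _) (∑₂-swap m k _)) (sym (∑₂-distrib-+ k _ _))

  ∑₂-∑V-swap : ∀ k n (F : Vec₂ k → V n → ℤ) →
    ∑₂ k (λ c → ∑V n (λ v → F c v)) ≡ ∑V n (λ v → ∑₂ k (λ c → F c v))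
  ∑₂-∑V-swap k n F = trans (∑₂-swap k n _) (∑₂-cong n λ a → ∑₂-swap k n _)

  ∑₂-translate : ∀ m (f : Vec₂ m → ℤ) (t : Vec₂ m) → ∑₂ m (λ a → f (a ⊕v t)) ≡ ∑₂ m f
  ∑₂-translate zero f [] = refl
  ∑₂-translate (suc m) f (false ∷ t) =
    cong₂ _+_ (∑₂-translate m (λ a → f (false ∷ a)) t) (∑₂-translate m (λ a → f (true ∷ a)) t)
  ∑₂-translate (suc m) f (true ∷ t) =
    trans (cong₂ _+_ (∑₂-translate m (λ a → f (true ∷ a)) t) (∑₂-translate m (λ a → f (false ∷ a)) t))
          (ℤ.+-comm (∑₂ m (λ a → f (true ∷ a))) (∑₂ m (λ a → f (false ∷ a))))

  ∑V-translate : ∀ n (f : V n → ℤ) (t : V n) → ∑V n (λ v → f (v ⊕ t)) ≡ ∑V n f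
  ∑V-translate n f (t₁ , t₂) =
    trans (∑₂-cong n (λ a → ∑₂-translate n (λ b → f (a ⊕v t₁ , b)) t₂))
          (∑₂-translate n (λ a → ∑₂ n (λ b → f (a , b))) t₁)

  𝟙 : Bool → ℤ
  𝟙 true = 1ℤ
  𝟙 false = 0ℤ

  sign : Bool → ℤ
  sign true = -1ℤ
  sign false = 1ℤ

  sign-xor : ∀ x y → sign (x xor y) ≡ sign x * sign y
  sign-xor true true = refl
  sign-xor true false = refl
  sign-xor false y = sym (ℤ.*-identityˡ (sign y))

  𝟙-∧ : ∀ x y → 𝟙 (x ∧ y) ≡ 𝟙 x * 𝟙 y
  𝟙-∧ true y = sym (ℤ.*-identityˡ (𝟙 y))
  𝟙-∧ false y = refl

  ∑₂-𝟙-isZero : ∀ m → ∑₂ m (λ a → 𝟙 (isZero a)) ≡ 1ℤ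
  ∑₂-𝟙-isZero zero = refl
  ∑₂-𝟙-isZero (suc m) = trans (cong₂ _+_ (∑₂-𝟙-isZero m) (trans (∑₂-const m 0ℤ) (ℤ.*-zeroʳ (two^ m)))) refl

  -- A new coordinate contributes the factor 1 + sign b.
  ∑-step : ∀ m b (t : ℤ) → two^ m * t + sign b * (two^ m * t) ≡ two^ (suc m) * (𝟙 (not b) * t)
  ∑-step m true t = trans (x-x (two^ m * t)) (sym (ℤ.*-zeroʳ (two^ (suc m))))
    where
    x-x : ∀ (x : ℤ) → x + -1ℤ * x ≡ 0ℤ
    x-x = solve-∀
  ∑-step m false t = trans (x+x (two^ m) t) (cong (_* (1ℤ * t)) (sym (two^-suc m)))
    where
    x+x : ∀ (x t : ℤ) → x * t + 1ℤ * (x * t) ≡ (x + x) * (1ℤ * t)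
    x+x = solve-∀

  ∑₂-sign-dot : ∀ m (d : Vec₂ m) → ∑₂ m (λ a → sign (dot a d)) ≡ two^ m * 𝟙 (isZero d)
  ∑₂-sign-dot zero [] = refl
  ∑₂-sign-dot (suc m) (b ∷ d) = begin
    S + ∑₂ m (λ a → sign (b xor dot a d))
      ≡⟨ cong (λ t → S + t) (trans (∑₂-cong m (λ a → sign-xor b (dot a d))) (∑₂-*ˡ m (sign b) _)) ⟩
    S + sign b * S
      ≡⟨ cong (λ t → t + sign b * t) (∑₂-sign-dot m d) ⟩
    two^ m * 𝟙 (isZero d) + sign b * (two^ m * 𝟙 (isZero d))
      ≡⟨ ∑-step m b (𝟙 (isZero d)) ⟩
    two^ (suc m) * (𝟙 (not b) * 𝟙 (isZero d))
      ≡⟨ cong (two^ (suc m) *_) (sym (𝟙-∧ (not b) (isZero d))) ⟩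
    two^ (suc m) * 𝟙 (not b ∧ isZero d)   ∎
    where
    open ≡-Reasoning
    S = ∑₂ m (λ a → sign (dot a d))

  isZeroV : ∀ {n} → V n → Bool
  isZeroV (c , d) = isZero c ∧ isZero d

  isZeroV⇒≡zeroV : ∀ {n} (u : V n) → isZeroV u ≡ true → u ≡ zeroV
  isZeroV⇒≡zeroV (c , d) e with isZero c in c≡0 | isZero d in d≡0
  ... | true | true = cong₂ _,_ (isZero⇒≡zeros c c≡0) (isZero⇒≡zeros d d≡0)

  isZeroV-zeroV : ∀ n → isZeroV (zeroV {n}) ≡ true
  isZeroV-zeroV n = cong₂ _∧_ (isZero-zeros n) (isZero-zeros n)

  ∑V-sign-B : ∀ n (u : V n) → ∑V n (λ v → sign (B v u)) ≡ (two^ n * two^ n) * 𝟙 (isZeroV u)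
  ∑V-sign-B n (c , d) = begin
    ∑₂ n (λ a → ∑₂ n (λ b → sign (dot a d xor dot b c)))
      ≡⟨ ∑₂-cong n (λ a → trans (∑₂-cong n (λ b → sign-xor (dot a d) (dot b c))) (∑₂-*ˡ n (sign (dot a d)) _)) ⟩
    ∑₂ n (λ a → sign (dot a d) * ∑₂ n (λ b → sign (dot b c)))
      ≡⟨ ∑₂-cong n (λ a → trans (cong (sign (dot a d) *_) (∑₂-sign-dot n c)) (ℤ.*-comm (sign (dot a d)) _)) ⟩
    ∑₂ n (λ a → (two^ n * 𝟙 (isZero c)) * sign (dot a d))
      ≡⟨ trans (∑₂-*ˡ n (two^ n * 𝟙 (isZero c)) _) (cong ((two^ n * 𝟙 (isZero c)) *_) (∑₂-sign-dot n d)) ⟩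
    (two^ n * 𝟙 (isZero c)) * (two^ n * 𝟙 (isZero d))
      ≡⟨ rearrange (two^ n) (𝟙 (isZero c)) (𝟙 (isZero d)) ⟩
    (two^ n * two^ n) * (𝟙 (isZero c) * 𝟙 (isZero d))
      ≡⟨ cong ((two^ n * two^ n) *_) (sym (𝟙-∧ (isZero c) (isZero d))) ⟩
    (two^ n * two^ n) * 𝟙 (isZero c ∧ isZero d)   ∎
    where
    open ≡-Reasoning
    rearrange : ∀ (x y z : ℤ) → (x * y) * (x * z) ≡ (x * x) * (y * z)
    rearrange = solve-∀

  isOrthogonal : ∀ {n k} → V n → Vec (V n) k → Bool
  isOrthogonal v [] = true
  isOrthogonal v (w ∷ ws) = not (B v w) ∧ isOrthogonal v ws

  ∑₂-sign-B-span : ∀ {n} k (v : V n) (ws : Vec (V n) k) →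
    ∑₂ k (λ c → sign (B v (lin c ws))) ≡ two^ k * 𝟙 (isOrthogonal v ws)
  ∑₂-sign-B-span zero v [] = cong sign (B-zeroʳ v)
  ∑₂-sign-B-span (suc k) v (w ∷ ws) = begin
    ∑₂ k (λ c → sign (B v (zeroV ⊕ lin c ws))) + ∑₂ k (λ c → sign (B v (w ⊕ lin c ws)))
      ≡⟨ cong₂ _+_ (∑₂-cong k (λ c → cong (λ x → sign (B v x)) (⊕-identityˡ (lin c ws))))
                   (trans (∑₂-cong k (λ c → trans (cong sign (B-distribˡ-⊕ w (lin c ws) v)) (sign-xor (B v w) _)))
                          (∑₂-*ˡ k (sign (B v w)) _)) ⟩
    S + sign (B v w) * S
      ≡⟨ cong (λ t → t + sign (B v w) * t) (∑₂-sign-B-span k v ws) ⟩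
    two^ k * 𝟙 (isOrthogonal v ws) + sign (B v w) * (two^ k * 𝟙 (isOrthogonal v ws))
      ≡⟨ ∑-step k (B v w) (𝟙 (isOrthogonal v ws)) ⟩
    two^ (suc k) * (𝟙 (not (B v w)) * 𝟙 (isOrthogonal v ws))
      ≡⟨ cong (two^ (suc k) *_) (sym (𝟙-∧ (not (B v w)) (isOrthogonal v ws))) ⟩
    two^ (suc k) * 𝟙 (not (B v w) ∧ isOrthogonal v ws)   ∎
    where
    open ≡-Reasoning
    S = ∑₂ k (λ c → sign (B v (lin c ws)))

  independent-isZeroV : ∀ {n k} (ws : Vec (V n) k) → Independent ws → ∀ c → isZeroV (lin c ws) ≡ isZero c
  independent-isZeroV {n} {k} ws independent c = ≡-by-true (mk⇔
    (λ e → subst (λ c → isZero c ≡ true) (sym (independent c (isZeroV⇒≡zeroV _ e))) (isZero-zeros k))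
    (λ e → subst (λ x → isZeroV x ≡ true)
                 (sym (trans (cong (λ c → lin c ws) (isZero⇒≡zeros c e)) (lin-zeros ws))) (isZeroV-zeroV n)))

  #orthogonal : ∀ n {k} → Vec (V n) k → ℤ
  #orthogonal n ws = ∑V n (λ v → 𝟙 (isOrthogonal v ws))

  -- Double counting of ∑_c ∑_v sign (B v w_c).
  #orthogonal-independent : ∀ n {k} (ws : Vec (V n) k) → Independent ws →
    two^ k * #orthogonal n ws ≡ two^ n * two^ n
  #orthogonal-independent n {k} ws independent = begin
    two^ k * ∑V n (λ v → 𝟙 (isOrthogonal v ws))
      ≡⟨ sym (∑V-*ˡ n (two^ k) _) ⟩
    ∑V n (λ v → two^ k * 𝟙 (isOrthogonal v ws))
      ≡⟨ ∑V-cong n (λ v → sym (∑₂-sign-B-span k v ws)) ⟩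
    ∑V n (λ v → ∑₂ k (λ c → sign (B v (lin c ws))))
      ≡⟨ sym (∑₂-∑V-swap k n _) ⟩
    ∑₂ k (λ c → ∑V n (λ v → sign (B v (lin c ws))))
      ≡⟨ ∑₂-cong k (λ c → trans (∑V-sign-B n (lin c ws))
                                (cong (λ b → (two^ n * two^ n) * 𝟙 b) (independent-isZeroV ws independent c))) ⟩
    ∑₂ k (λ c → (two^ n * two^ n) * 𝟙 (isZero c))
      ≡⟨ trans (∑₂-*ˡ k (two^ n * two^ n) (λ c → 𝟙 (isZero c))) (cong ((two^ n * two^ n) *_) (∑₂-𝟙-isZero k)) ⟩
    (two^ n * two^ n) * 1ℤ
      ≡⟨ ℤ.*-identityʳ _ ⟩
    two^ n * two^ n   ∎
    where open ≡-Reasoning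

  ∑₂-nonneg : ∀ m (f : Vec₂ m → ℤ) → (∀ a → 0ℤ ≤ f a) → 0ℤ ≤ ∑₂ m f
  ∑₂-nonneg zero f f≥0 = f≥0 []
  ∑₂-nonneg (suc m) f f≥0 =
    ℤ.+-mono-≤ (∑₂-nonneg m _ (λ a → f≥0 (false ∷ a))) (∑₂-nonneg m _ (λ a → f≥0 (true ∷ a)))

  ∑₂-≥-at-zeros : ∀ m (f : Vec₂ m → ℤ) → (∀ a → 0ℤ ≤ f a) → f zeros ≤ ∑₂ m f
  ∑₂-≥-at-zeros zero f f≥0 = ℤ.≤-refl
  ∑₂-≥-at-zeros (suc m) f f≥0 = ℤ.≤-trans (ℤ.≤-reflexive (sym (ℤ.+-identityʳ _)))
    (ℤ.+-mono-≤ (∑₂-≥-at-zeros m _ (λ a → f≥0 (false ∷ a))) (∑₂-nonneg m _ (λ a → f≥0 (true ∷ a))))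

  ∑V-≥-at-zeroV : ∀ n (f : V n → ℤ) → (∀ v → 0ℤ ≤ f v) → f zeroV ≤ ∑V n f
  ∑V-≥-at-zeroV n f f≥0 = ℤ.≤-trans (∑₂-≥-at-zeros n (λ b → f (zeros , b)) (λ b → f≥0 _))
    (∑₂-≥-at-zeros n (λ a → ∑₂ n (λ b → f (a , b))) (λ a → ∑₂-nonneg n _ (λ b → f≥0 _)))

  ∑₂-mono : ∀ m {f g : Vec₂ m → ℤ} → (∀ a → f a ≤ g a) → ∑₂ m f ≤ ∑₂ m g
  ∑₂-mono zero f≤g = f≤g []
  ∑₂-mono (suc m) f≤g = ℤ.+-mono-≤ (∑₂-mono m (λ a → f≤g (false ∷ a))) (∑₂-mono m (λ a → f≤g (true ∷ a)))

  ∑V-mono : ∀ n {f g : V n → ℤ} → (∀ v → f v ≤ g v) → ∑V n f ≤ ∑V n g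
  ∑V-mono n f≤g = ∑₂-mono n λ a → ∑₂-mono n λ b → f≤g (a , b)

  ∑₂-positive : ∀ m (f : Vec₂ m → ℤ) → 0ℤ < ∑₂ m f → Σ (Vec₂ m) λ a → 0ℤ < f a
  ∑₂-positive zero f pos = [] , pos
  ∑₂-positive (suc m) f pos with 0ℤ ℤ.<? ∑₂ m (λ a → f (false ∷ a))
  ... | yes pos₀ = let (a , fa>0) = ∑₂-positive m _ pos₀ in false ∷ a , fa>0
  ... | no ¬pos₀ = let (a , fa>0) = ∑₂-positive m _ pos₁ in true ∷ a , fa>0
    where
    pos₁ : 0ℤ < ∑₂ m (λ a → f (true ∷ a))
    pos₁ = ℤ.≰⇒> λ le → ℤ.<-irrefl refl (ℤ.<-≤-trans pos (ℤ.+-mono-≤ (ℤ.≮⇒≥ ¬pos₀) le))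

  ∑V-positive : ∀ n (f : V n → ℤ) → 0ℤ < ∑V n f → Σ (V n) λ v → 0ℤ < f v
  ∑V-positive n f pos with ∑₂-positive n _ pos
  ... | a , pos-a with ∑₂-positive n _ pos-a
  ... | b , pos-ab = (a , b) , pos-ab

  ∑V-sign-φ[] : ∀ n (p : V n) → ∑V n (λ v → sign (φ[ p ] v)) ≡ sign (φ₀ p) * two^ n
  ∑V-sign-φ[] n p = begin
    ∑V n (λ v → sign (φ[ p ] v))
      ≡⟨ ∑V-cong n (λ v → trans (cong sign (φ[]-translate p v))
                                (trans (sign-xor (φ₀ (v ⊕ p)) (φ₀ p)) (ℤ.*-comm (sign (φ₀ (v ⊕ p))) (sign (φ₀ p))))) ⟩
    ∑V n (λ v → sign (φ₀ p) * sign (φ₀ (v ⊕ p)))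
      ≡⟨ trans (∑V-*ˡ n (sign (φ₀ p)) _) (cong (sign (φ₀ p) *_) (∑V-translate n (λ v → sign (φ₀ v)) p)) ⟩
    sign (φ₀ p) * ∑V n (λ v → sign (φ₀ v))
      ≡⟨ cong (sign (φ₀ p) *_) ∑V-sign-φ₀ ⟩
    sign (φ₀ p) * two^ n   ∎
    where
    open ≡-Reasoning
    ∑V-sign-φ₀ : ∑V n (λ v → sign (φ₀ v)) ≡ two^ n
    ∑V-sign-φ₀ = trans (∑₂-cong n (λ a → trans (∑₂-cong n (λ b → cong sign (dot-comm a b))) (∑₂-sign-dot n a)))
      (trans (∑₂-*ˡ n (two^ n) (λ a → 𝟙 (isZero a)))
             (trans (cong (two^ n *_) (∑₂-𝟙-isZero n)) (ℤ.*-identityʳ (two^ n))))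

  -- Translating by the span W of ws: on v + w, φ changes by B(v, w), and summing these signs over W leaves
  -- only v ⊥ W.
  ∑V-sign-orthogonal : ∀ {n k} (φ : Form n) → Polarises φ → (ws : Vec (V n) k) → (∀ c → φ (lin c ws) ≡ false) →
    ∑V n (λ v → sign (φ v)) ≡ ∑V n (λ v → sign (φ v) * 𝟙 (isOrthogonal v ws))
  ∑V-sign-orthogonal {n} {k} φ pol ws singular = ℤ.*-cancelˡ-≡ (two^ k) _ _ {{ℕ.m^n≢0 2 k}} (begin
    two^ k * S
      ≡⟨ sym (∑₂-const k S) ⟩
    ∑₂ k (λ c → S)
      ≡⟨ ∑₂-cong k (λ c → sym (∑V-translate n (λ v → sign (φ v)) (lin c ws))) ⟩
    ∑₂ k (λ c → ∑V n (λ v → sign (φ (v ⊕ lin c ws))))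
      ≡⟨ ∑₂-∑V-swap k n _ ⟩
    ∑V n (λ v → ∑₂ k (λ c → sign (φ (v ⊕ lin c ws))))
      ≡⟨ ∑V-cong n (λ v → trans (∑₂-cong k (sign-translate v)) (∑₂-*ˡ k (sign (φ v)) _)) ⟩
    ∑V n (λ v → sign (φ v) * ∑₂ k (λ c → sign (B v (lin c ws))))
      ≡⟨ ∑V-cong n (λ v → trans (cong (sign (φ v) *_) (∑₂-sign-B-span k v ws))
                                (rearrange (sign (φ v)) (two^ k) (𝟙 (isOrthogonal v ws)))) ⟩
    ∑V n (λ v → two^ k * (sign (φ v) * 𝟙 (isOrthogonal v ws)))
      ≡⟨ ∑V-*ˡ n (two^ k) _ ⟩
    two^ k * ∑V n (λ v → sign (φ v) * 𝟙 (isOrthogonal v ws))   ∎)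
    where
    open ≡-Reasoning
    S = ∑V n (λ v → sign (φ v))
    sign-translate : ∀ v c → sign (φ (v ⊕ lin c ws)) ≡ sign (φ v) * sign (B v (lin c ws))
    sign-translate v c =
      trans (cong sign (trans (polarises-⊕ φ pol v (lin c ws))
                              (cong (λ t → (φ v xor t) xor B v (lin c ws)) (singular c))))
            (trans (cong (λ t → sign (t xor B v (lin c ws))) (xor-identityʳ (φ v))) (sign-xor (φ v) _))
    rearrange : ∀ (x y z : ℤ) → x * (y * z) ≡ y * (x * z)
    rearrange = solve-∀

  two^-count-contradiction : ∀ {n k} (N : ℤ) → n ℕ.≤ k → two^ k * N ≡ two^ n * two^ n → two^ n + + 2 ≤ N → ⊥
  two^-count-contradiction -[1+ m ] n≤k count ()
  two^-count-contradiction {n} {k} (+ m) n≤k count bound = ℕ.<-irrefl refl (begin-strict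
    2ⁿ ℕ.* 2ⁿ                ≤⟨ ℕ.m≤m+n (2ⁿ ℕ.* 2ⁿ) _ ⟩
    2ⁿ ℕ.* 2ⁿ ℕ.+ 0          <⟨ ℕ.+-monoʳ-< (2ⁿ ℕ.* 2ⁿ) (ℕ.m^n>0 2 (suc n)) ⟩
    2ⁿ ℕ.* 2ⁿ ℕ.+ 2 ℕ.* 2ⁿ   ≡⟨ cong (2ⁿ ℕ.* 2ⁿ ℕ.+_) (ℕ.*-comm 2 2ⁿ) ⟩
    2ⁿ ℕ.* 2ⁿ ℕ.+ 2ⁿ ℕ.* 2   ≡⟨ sym (ℕ.*-distribˡ-+ 2ⁿ 2ⁿ 2) ⟩
    2ⁿ ℕ.* (2ⁿ ℕ.+ 2)        ≤⟨ ℕ.*-mono-≤ (ℕ.^-monoʳ-≤ 2 n≤k)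
                                            (ℤ.drop‿+≤+ (subst (_≤ + m) (sym (ℤ.pos-+ 2ⁿ 2)) bound)) ⟩
    2 ^ k ℕ.* m              ≡⟨ ℤ.+-injective (trans (ℤ.pos-* (2 ^ k) m) (trans count (sym (ℤ.pos-* 2ⁿ 2ⁿ)))) ⟩
    2ⁿ ℕ.* 2ⁿ                ∎)
    where
    open ℕ.≤-Reasoning
    2ⁿ = 2 ^ n

  isOrthogonal-zeroV : ∀ {n k} (ws : Vec (V n) k) → isOrthogonal zeroV ws ≡ true
  isOrthogonal-zeroV [] = refl
  isOrthogonal-zeroV (w ∷ ws) = cong₂ _∧_ (cong not (B-zeroˡ w)) (isOrthogonal-zeroV ws)

  -- Σ sign φ[ p ] = -2ⁿ forces more than 2ⁿ vectors orthogonal to a totally singular span, but there are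
  -- only 2^(2n-k).
  witt-bound : ∀ {n k} (p : V n) → φ₀ p ≡ true → (ws : Vec (V n) k) → Independent ws →
    (∀ c → φ[ p ] (lin c ws) ≡ false) → k ℕ.< n
  witt-bound {n} {k} p arf ws independent singular with k ℕ.<? n
  ... | yes k<n = k<n
  ... | no k≮n = ⊥-elim (two^-count-contradiction (#orthogonal n ws) (ℕ.≮⇒≥ k≮n)
                           (#orthogonal-independent n ws independent) many-orthogonal)
    where
    N = #orthogonal n ws
    T = ∑V n (λ v → sign (φ[ p ] v) * 𝟙 (isOrthogonal v ws))
    T≡-2ⁿ : T ≡ -1ℤ * two^ n
    T≡-2ⁿ = trans (sym (∑V-sign-orthogonal φ[ p ] (φ[]-polarises p) ws singular))
                  (trans (∑V-sign-φ[] n p) (cong (λ b → sign b * two^ n) arf))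
    f : V n → ℤ
    f v = sign (φ[ p ] v) * 𝟙 (isOrthogonal v ws) + 𝟙 (isOrthogonal v ws)
    f≥0 : ∀ v → 0ℤ ≤ f v
    f≥0 v with φ[ p ] v | isOrthogonal v ws
    ... | true | true = +≤+ ℕ.z≤n
    ... | true | false = +≤+ ℕ.z≤n
    ... | false | true = +≤+ ℕ.z≤n
    ... | false | false = +≤+ ℕ.z≤n
    f0≡2 : f zeroV ≡ + 2
    f0≡2 = cong₂ (λ a b → sign a * 𝟙 b + 𝟙 b) (polarises-zero φ[ p ] (φ[]-polarises p)) (isOrthogonal-zeroV ws)
    T+N≥2 : + 2 ≤ T + N
    T+N≥2 = ℤ.≤-trans (ℤ.≤-reflexive (sym f0≡2))
                      (ℤ.≤-trans (∑V-≥-at-zeroV n f f≥0) (ℤ.≤-reflexive (∑V-distrib-+ n _ _)))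
    many-orthogonal : two^ n + + 2 ≤ N
    many-orthogonal = ℤ.≤-trans (ℤ.+-monoʳ-≤ (two^ n) T+N≥2)
                                (ℤ.≤-reflexive (trans (cong (λ t → two^ n + (t + N)) T≡-2ⁿ) (cancel (two^ n) N)))
      where
      cancel : ∀ (x y : ℤ) → x + (-1ℤ * x + y) ≡ y
      cancel = solve-∀

  ∑V-𝟙-U : ∀ n → ∑V n (λ v → 𝟙 (isZero (proj₂ v))) ≡ two^ n
  ∑V-𝟙-U n = trans (∑₂-cong n (λ a → ∑₂-𝟙-isZero n)) (trans (∑₂-const n 1ℤ) (ℤ.*-identityʳ (two^ n)))

  ∑V-𝟙-point : ∀ n (q : V n) → ∑V n (λ v → 𝟙 (isZeroV (v ⊕ q))) ≡ 1ℤ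
  ∑V-𝟙-point n q = trans (∑V-translate n (λ v → 𝟙 (isZeroV v)) q)
    (trans (∑₂-cong n (λ a → trans (∑₂-cong n (λ b → 𝟙-∧ (isZero a) (isZero b)))
                              (trans (∑₂-*ˡ n (𝟙 (isZero a)) (λ b → 𝟙 (isZero b)))
                                     (trans (cong (𝟙 (isZero a) *_) (∑₂-𝟙-isZero n)) (ℤ.*-identityʳ _)))))
           (∑₂-𝟙-isZero n))

  𝟙-nonneg : ∀ b → 0ℤ ≤ 𝟙 b
  𝟙-nonneg true = +≤+ ℕ.z≤n
  𝟙-nonneg false = +≤+ ℕ.z≤n

  -- n independent vectors have exactly 2ⁿ orthogonal vectors, so no room for U and one more.
  ¬U⊂orthogonal-complement : ∀ {n} (fam : Vec (V n) n) → Independent fam →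
    (∀ u → InU u → isOrthogonal u fam ≡ true) →
    (q : V n) → isZero (proj₂ q) ≡ false → isOrthogonal q fam ≡ true → ⊥
  ¬U⊂orthogonal-complement {n} fam independent U⊥fam q q∉U q⊥fam =
    ℤ.<-irrefl refl (ℤ.<-≤-trans 2ⁿ<2ⁿ+1 (ℤ.≤-trans 2ⁿ+1≤N (ℤ.≤-reflexive N≡2ⁿ)))
    where
    N = #orthogonal n fam
    N≡2ⁿ : N ≡ two^ n
    N≡2ⁿ = ℤ.*-cancelˡ-≡ (two^ n) N (two^ n) {{ℕ.m^n≢0 2 n}} (#orthogonal-independent n fam independent)
    pointwise : ∀ y → 𝟙 (isZero (proj₂ y)) + 𝟙 (isZeroV (y ⊕ q)) ≤ 𝟙 (isOrthogonal y fam)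
    pointwise y with isZero (proj₂ y) in y∈U | isZeroV (y ⊕ q) in y≡q
    ... | true | true = ⊥-elim (¬isZero⇒≢zeros _ q∉U (trans (cong proj₂ (sym y≡q′)) (isZero⇒≡zeros _ y∈U)))
      where
      y≡q′ : y ≡ q
      y≡q′ = ⊕.x+y≡0⇒x≡y y q (isZeroV⇒≡zeroV _ y≡q)
    ... | true | false = ℤ.≤-reflexive (cong 𝟙 (sym (U⊥fam y (isZero⇒≡zeros _ y∈U))))
    ... | false | true = ℤ.≤-reflexive (cong 𝟙 (sym (subst (λ x → isOrthogonal x fam ≡ true)
                                                        (sym (⊕.x+y≡0⇒x≡y y q (isZeroV⇒≡zeroV _ y≡q))) q⊥fam)))
    ... | false | false = 𝟙-nonneg _
    2ⁿ+1≤N : two^ n + 1ℤ ≤ N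
    2ⁿ+1≤N = ℤ.≤-trans (ℤ.≤-reflexive (sym (cong₂ _+_ (∑V-𝟙-U n) (∑V-𝟙-point n q))))
                       (ℤ.≤-trans (ℤ.≤-reflexive (sym (∑V-distrib-+ n _ _))) (∑V-mono n pointwise))
    2ⁿ<2ⁿ+1 : two^ n < two^ n + 1ℤ
    2ⁿ<2ⁿ+1 = subst (two^ n <_) (ℤ.pos-+ (2 ^ n) 1) (+<+ (ℕ.m<m+n (2 ^ n) (ℕ.s≤s ℕ.z≤n)))

  -- k independent vectors in V (k + 1) have 2^(k+2) orthogonal vectors, more than the 2^(k+1) in U.
  orthogonal-outside-U : ∀ {k} (ws : Vec (V (suc k)) k) → Independent ws →
    Σ (V (suc k)) λ v → (isOrthogonal v ws ≡ true) × (isZero (proj₂ v) ≡ false)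
  orthogonal-outside-U {k} ws independent = v , both-hold (isOrthogonal v ws) (isZero (proj₂ v)) (proj₂ found)
    where
    n = suc k
    f₁ f₂ : V n → ℤ
    f₁ v = 𝟙 (isOrthogonal v ws) * 𝟙 (isZero (proj₂ v))
    f₂ v = 𝟙 (isOrthogonal v ws) * 𝟙 (not (isZero (proj₂ v)))
    split : ∀ v → f₁ v + f₂ v ≡ 𝟙 (isOrthogonal v ws)
    split v with isOrthogonal v ws | isZero (proj₂ v)
    ... | true | true = refl
    ... | true | false = refl
    ... | false | true = refl
    ... | false | false = refl
    f₁≤ : ∀ v → f₁ v ≤ 𝟙 (isZero (proj₂ v))
    f₁≤ v with isOrthogonal v ws | isZero (proj₂ v)
    ... | true | true = ℤ.≤-refl
    ... | true | false = ℤ.≤-refl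
    ... | false | true = +≤+ ℕ.z≤n
    ... | false | false = ℤ.≤-refl
    N≡2ⁿ+2ⁿ : #orthogonal n ws ≡ two^ n + two^ n
    N≡2ⁿ+2ⁿ = ℤ.*-cancelˡ-≡ (two^ k) _ _ {{ℕ.m^n≢0 2 k}}
      (trans (#orthogonal-independent n ws independent)
             (trans (cong (λ z → z * z) (two^-suc k))
                    (trans (rearrange (two^ k)) (cong (λ z → two^ k * (z + z)) (sym (two^-suc k))))))
      where
      rearrange : ∀ (x : ℤ) → (x + x) * (x + x) ≡ x * ((x + x) + (x + x))
      rearrange = solve-∀
    ∑f₂>0 : 0ℤ < ∑V n f₂
    ∑f₂>0 = ℤ.≰⇒> λ ∑f₂≤0 → ℤ.<-irrefl refl (begin-strict
      #orthogonal n ws        ≡⟨ trans (sym (∑V-cong n split)) (∑V-distrib-+ n f₁ f₂) ⟩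
      ∑V n f₁ + ∑V n f₂       ≤⟨ ℤ.+-mono-≤ (ℤ.≤-trans (∑V-mono n f₁≤) (ℤ.≤-reflexive (∑V-𝟙-U n)))
                                              ∑f₂≤0 ⟩
      two^ n + 0ℤ             <⟨ ℤ.+-monoʳ-< (two^ n) (+<+ (ℕ.m^n>0 2 n)) ⟩
      two^ n + two^ n         ≡⟨ sym N≡2ⁿ+2ⁿ ⟩
      #orthogonal n ws        ∎)
      where open ℤ.≤-Reasoning
    found = ∑V-positive n f₂ ∑f₂>0
    v = proj₁ found
    both-hold : ∀ x y → 0ℤ < 𝟙 x * 𝟙 (not y) → (x ≡ true) × (y ≡ false)
    both-hold true false _ = refl , refl
    both-hold true true (+<+ ())
    both-hold false y (+<+ ())

search₂ : ∀ m (p : Vec₂ m → Bool) → (Σ (Vec₂ m) λ c → p c ≡ true) ⊎ (∀ c → p c ≡ false)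
search₂ zero p with p [] in e
... | true = inj₁ ([] , e)
... | false = inj₂ λ { [] → e }
search₂ (suc m) p with search₂ m (λ c → p (false ∷ c)) | search₂ m (λ c → p (true ∷ c))
... | inj₁ (c , e) | _ = inj₁ (false ∷ c , e)
... | inj₂ _ | inj₁ (c , e) = inj₁ (true ∷ c , e)
... | inj₂ f | inj₂ g = inj₂ λ { (false ∷ c) → f c ; (true ∷ c) → g c }

independent? : ∀ {n m} (fam : Vec (V n) m) →
  (Σ (Vec₂ m) λ c → (lin c fam ≡ zeroV) × (isZero c ≡ false)) ⊎ Independent fam
independent? {n} {m} fam with search₂ m (λ c → isZeroV (lin c fam) ∧ not (isZero c))
... | inj₁ (c , e) = inj₁ (c , relation (isZeroV (lin c fam)) (isZero c) refl refl e)
  where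
  relation : ∀ x y → isZeroV (lin c fam) ≡ x → isZero c ≡ y → x ∧ not y ≡ true →
    (lin c fam ≡ zeroV) × (isZero c ≡ false)
  relation true false e₁ e₂ _ = isZeroV⇒≡zeroV _ e₁ , e₂
... | inj₂ f = inj₂ λ c e → isZero⇒≡zeros c (trivial (isZero c) (f c) (trans (cong isZeroV e) (isZeroV-zeroV n)))
  where
  trivial : ∀ {x} y → x ∧ not y ≡ false → x ≡ true → y ≡ true
  trivial true _ _ = refl
  trivial {true} false () refl

B-span⇒isOrthogonal : ∀ {n k} (v : V n) (ws : Vec (V n) k) → (∀ c → B v (lin c ws) ≡ false) → isOrthogonal v ws ≡ true
B-span⇒isOrthogonal v [] h = refl
B-span⇒isOrthogonal v (w ∷ ws) h =
  cong₂ _∧_ (cong not v⊥w) (B-span⇒isOrthogonal v ws λ c → trans (sym (drop-zero c)) (h (false ∷ c)))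
  where
  drop-zero : ∀ c → B v (zeroV ⊕ lin c ws) ≡ B v (lin c ws)
  drop-zero c = cong (B v) (⊕-identityˡ _)
  v⊥w : B v w ≡ false
  v⊥w = trans (cong (B v) (sym (trans (cong (w ⊕_) (lin-zeros ws)) (⊕.+-identityʳ w)))) (h (true ∷ zeros))

isOrthogonal⇒B-span : ∀ {n k} (v : V n) (ws : Vec (V n) k) → isOrthogonal v ws ≡ true → ∀ c → B v (lin c ws) ≡ false
isOrthogonal⇒B-span v [] e [] = B-zeroʳ v
isOrthogonal⇒B-span v (w ∷ ws) e (x ∷ c) with B v w in v·w
isOrthogonal⇒B-span v (w ∷ ws) e (true ∷ c) | false =
  trans (B-distribˡ-⊕ w _ v) (cong₂ _xor_ v·w (isOrthogonal⇒B-span v ws e c))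
isOrthogonal⇒B-span v (w ∷ ws) e (false ∷ c) | false =
  trans (cong (B v) (⊕-identityˡ _)) (isOrthogonal⇒B-span v ws e c)

-- If a were not in the span, adding (a , 0) gives n independent vectors whose orthogonal complement contains
-- U and (0 , h).
independent-hyperplane-spans : ∀ {k} (ws : Vec (V (suc k)) k) → Independent ws → (∀ c → InU (lin c ws)) →
  (h : Vec₂ (suc k)) → isZero h ≡ false → (∀ c → dot (proj₁ (lin c ws)) h ≡ false) →
  ∀ a → dot a h ≡ false → Σ (Vec₂ k) λ c → lin c ws ≡ (a , zeros)
independent-hyperplane-spans ws independent ws⊂U h h≢0 ws⊥h a a⊥h with independent? ((a , zeros) ∷ ws)
... | inj₁ (true ∷ c , e , _) = c , sym (⊕.x+y≡0⇒x≡y (a , zeros) (lin c ws) e)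
... | inj₁ (false ∷ c , e , c≢0) = ⊥-elim (¬isZero⇒≢zeros c c≢0 (independent c (trans (sym (⊕-identityˡ _)) e)))
... | inj₂ independent′ = ⊥-elim (¬U⊂orthogonal-complement fam independent′ U⊥fam q h≢0 q⊥fam)
  where
  fam = (a , zeros) ∷ ws
  q = zeros , h
  U⊥fam : ∀ u → InU u → isOrthogonal u fam ≡ true
  U⊥fam u u∈U = cong₂ _∧_ (cong not (U-totallyIsotropic u (a , zeros) u∈U refl))
                          (B-span⇒isOrthogonal u ws λ c → U-totallyIsotropic u _ u∈U (ws⊂U c))
  q⊥fam : isOrthogonal q fam ≡ true
  q⊥fam = cong₂ _∧_ (cong not (trans (B-on-U q (a , zeros) refl) a⊥h))
                    (B-span⇒isOrthogonal q ws λ c → trans (B-on-U q _ (ws⊂U c)) (ws⊥h c))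

HasNormal : ∀ {n} → Vec₂ n → Hyp n → Set
HasNormal h H = ∀ x → memH H x ⇔ (InU x × (dot (proj₁ x) h ≡ false))

-- The image of e₁, …, e_k under an involution T carrying {x | x₀ = 0} onto {x | x · h = 0}.
module HyperplaneBasis {k} (h : Vec₂ (suc k)) (h≢0 : isZero h ≡ false) where

  private
    transv = transvection-between h (unit zero) h≢0 refl
    T = proj₁ transv
    T-involutive : ∀ x → vecMat (vecMat x T) T ≡ x
    T-involutive = vecMat-inverse (proj₁ (proj₁ (proj₂ transv)))
    T-moves : ∀ x → dot (vecMat x T) h ≡ dot x (unit zero)
    T-moves = proj₂ (proj₂ transv)

  basis : Vec (V (suc k)) k
  basis = zipWith _,_ (tail T) (replicate k zeros)

  lin-basis : ∀ c → lin c basis ≡ (vecMat (false ∷ c) T , zeros)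
  lin-basis c = trans (lin-zip c (tail T) (replicate k zeros)) (cong₂ _,_ (vecMat-tail T) (vecMat-zeroʳ c))
    where
    vecMat-tail : (M : Mat (suc k)) → vecMat c (tail M) ≡ vecMat (false ∷ c) M
    vecMat-tail (r ∷ M) = sym (⊕v-identityˡ _)

  basis-⊥h : ∀ c → dot (vecMat (false ∷ c) T) h ≡ false
  basis-⊥h c = trans (T-moves (false ∷ c)) (dot-zeroʳ c)

  basis-independent : Independent basis
  basis-independent c e = cong tail (trans (sym (T-involutive (false ∷ c)))
    (trans (cong (λ v → vecMat v T) (cong proj₁ (trans (sym (lin-basis c)) e))) (vecMat-zeroˡ T)))

  -- (a T)₀ = (a T T) · h = a · h = 0, so a T = false ∷ c and a = (false ∷ c) T.
  basis-spans : ∀ a → dot a h ≡ false → Σ (Vec₂ k) λ c → lin c basis ≡ (a , zeros)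
  basis-spans a a⊥h = tail (vecMat a T) ,
    trans (lin-basis _) (cong (_, zeros) (trans (cong (λ v → vecMat v T) aT≡false∷) (T-involutive a)))
    where
    aT≡false∷ : false ∷ tail (vecMat a T) ≡ vecMat a T
    aT≡false∷ with vecMat a T | trans (sym (dot-unitʳ zero (vecMat a T)))
                                    (trans (sym (T-moves (vecMat a T))) (trans (cong (λ v → dot v h) (T-involutive a)) a⊥h))
    ... | false ∷ _ | _ = refl

hyperplane : ∀ {k} (h : Vec₂ (suc k)) → isZero h ≡ false → Σ (Hyp (suc k)) (HasNormal h)
hyperplane {k} h h≢0 = H , normal
  where
  open HyperplaneBasis h h≢0
  H : Hyp (suc k)
  H = record { basis = basis ; indep = basis-independent } , λ { x (c , refl) → cong proj₂ (lin-basis c) }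
  normal : HasNormal h H
  normal x = mk⇔
    (λ { (c , refl) → cong proj₂ (lin-basis c) , trans (cong (λ v → dot (proj₁ v) h) (lin-basis c)) (basis-⊥h c) })
    (λ { (x∈U , x⊥h) → let (c , e) = basis-spans (proj₁ x) x⊥h in c , trans e (cong (proj₁ x ,_) (sym x∈U)) })

-- The Arf invariant: φ[ p ] ∈ 𝒬⁻ iff φ₀ p = 1

arf⇒nonzero : ∀ {n} (p : V n) → φ₀ p ≡ true → isZero (proj₂ p) ≡ false
arf⇒nonzero (p₁ , p₂) arf with isZero p₂ in p₂≡0
... | false = refl
... | true with trans (sym arf) (trans (cong (dot p₁) (isZero⇒≡zeros p₂ p₂≡0)) (dot-zeroʳ p₁))
...   | ()

-- The hyperplane of U with normal p₂ is totally singular; the Witt bound excludes anything larger.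
arf⇒QM : ∀ {k} (p : V (suc k)) → φ₀ p ≡ true → QM φ[ p ]
arf⇒QM {k} p arf = φ[]-polarises p , (proj₁ H , singular) , bound
  where
  H = proj₁ (hyperplane (proj₂ p) (arf⇒nonzero p arf))
  normal = proj₂ (hyperplane (proj₂ p) (arf⇒nonzero p arf))
  singular : TotSing φ[ p ] (proj₁ H)
  singular (a , b) x∈H with to (normal (a , b)) x∈H
  ... | refl , a⊥p₂ = trans (φ[]-on-U p a) a⊥p₂
  bound : ∀ m (S : Subsp (suc k) m) → TotSing φ[ p ] S → m ℕ.≤ k
  bound m S singularS = ℕ.s≤s⁻¹ (witt-bound p arf (Subsp.basis S) (Subsp.indep S) (λ c → singularS _ (c , refl)))

-- φ[ p ] vanishes on U if p₂ = 0, and otherwise on {(c M , c)} for M = e_i ⊗ p₁ + p₁ ⊗ e_i with p₂ᵢ = 1.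
totally-singular-of-arf-zero : ∀ {n} (p : V n) → φ₀ p ≡ false →
  Σ (Vec (V n) n) λ fam → Independent fam × (∀ c → φ[ p ] (lin c fam) ≡ false)
totally-singular-of-arf-zero {n} (p₁ , p₂) arf with isZero p₂ in p₂≡0
... | true = zipWith _,_ idMat (replicate n zeros) ,
    (λ c e → trans (cong proj₁ (sym (lin-U c))) (cong proj₁ e)) ,
    λ c → trans (cong φ[ p₁ , p₂ ] (lin-U c))
                (trans (φ[]-on-U (p₁ , p₂) c) (trans (cong (dot c) (isZero⇒≡zeros p₂ p₂≡0)) (dot-zeroʳ c)))
  where
  lin-U : ∀ c → lin c (zipWith _,_ idMat (replicate n zeros)) ≡ (c , zeros)
  lin-U c = trans (lin-zip c idMat (replicate n zeros)) (cong₂ _,_ (vecMat-identity c) (vecMat-zeroʳ c))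
... | false = zipWith _,_ M idMat ,
    (λ c e → trans (sym (vecMat-identity c)) (cong proj₂ (trans (sym (lin-zip c M idMat)) e))) ,
    λ c → trans (cong φ[ p₁ , p₂ ] (trans (lin-zip c M idMat) (cong (vecMat c M ,_) (vecMat-identity c)))) (vanishes c)
  where
  pivot = nonzero-coordinate p₂ p₂≡0
  u = unit (proj₁ pivot)
  M = symOuter u p₁
  vanishes : ∀ c → φ[ p₁ , p₂ ] (vecMat c M , c) ≡ false
  vanishes c = begin
    dot (vecMat c M) c xor (dot (vecMat c M) p₂ xor dot c p₁)
      ≡⟨ cong₂ (λ x y → x xor (y xor dot c p₁)) (symOuter-alternating u p₁ c) (dot-symOuter c u p₁ p₂) ⟩
    ((dot c u ∧ dot p₁ p₂) xor (dot c p₁ ∧ dot u p₂)) xor dot c p₁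
      ≡⟨ cong₂ (λ x y → ((dot c u ∧ x) xor (dot c p₁ ∧ y)) xor dot c p₁)
               arf (trans (dot-unitˡ (proj₁ pivot) p₂) (proj₂ pivot)) ⟩
    ((dot c u ∧ false) xor (dot c p₁ ∧ true)) xor dot c p₁
      ≡⟨ solve 2 (λ a b → ((a :* con false) :+ (b :* con true)) :+ b := con false) refl (dot c u) (dot c p₁) ⟩
    false   ∎
    where open ≡-Reasoning

QM⇒arf : ∀ {k} (p : V (suc k)) → QM φ[ p ] → φ₀ p ≡ true
QM⇒arf {k} p (_ , _ , bound) with φ₀ p in arf
... | true = refl
... | false with totally-singular-of-arf-zero p arf
...   | fam , independent , singular =
  ⊥-elim (ℕ.<-irrefl refl (bound (suc k) (record { basis = fam ; indep = independent }) (λ { x (c , refl) → singular c })))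

QM⇒φ[] : ∀ {k} (φ : Form (suc k)) → QM φ → Σ (V (suc k)) λ p → (φ ≗F φ[ p ]) × (φ₀ p ≡ true)
QM⇒φ[] φ φ∈𝒬 = p , φ≗ , QM⇒arf p (QM-resp-≗ φ≗ φ∈𝒬)
  where
  p = proj₁ (polarises⇒φ[] φ (proj₁ φ∈𝒬))
  φ≗ = proj₂ (polarises⇒φ[] φ (proj₁ φ∈𝒬))

QM-∘ : ∀ {n} (g : Isom n) (φ : Form n) → QM φ → QM (λ x → φ (fun g x))
QM-∘ {n} g φ (pol , (S , singular) , bound) = pol′ , (S′ , singular′) , bound′
  where
  pol′ : Polarises (λ x → φ (fun g x))
  pol′ x y = trans (sym (isometry g x y))
    (trans (pol (fun g x) (fun g y)) (cong (λ z → (φ z xor φ (fun g x)) xor φ (fun g y)) (sym (additive g x y))))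
  image : ∀ {m} (f : V n → V n) → Additive f → (∀ x → f x ≡ zeroV → x ≡ zeroV) → Subsp n m → Subsp n m
  image f additive-f ker-f T = record
    { basis = map f (Subsp.basis T) ; indep = independent-map f additive-f ker-f _ (Subsp.indep T) }
  S′ = image (inv g) (inv-additive g) (fun-kernel (invIsom g)) S
  singular′ : TotSing (λ x → φ (fun g x)) S′
  singular′ x (c , refl) = trans (cong (λ z → φ (fun g z)) (lin-map (inv g) (inv-additive g) c (Subsp.basis S)))
                                 (trans (cong φ (fun-inv g _)) (singular _ (c , refl)))
  bound′ : ∀ m (T : Subsp n m) → TotSing (λ x → φ (fun g x)) T → m ℕ.≤ _
  bound′ m T singularT = bound m (image (fun g) (additive g) (fun-kernel g) T)
    λ { x (c , refl) → trans (cong φ (lin-map (fun g) (additive g) c (Subsp.basis T))) (singularT _ (c , refl)) }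

QM-∘⇔ : ∀ {n} (g : Isom n) (φ : Form n) → QM φ ⇔ QM (λ x → φ (fun g x))
QM-∘⇔ g φ = mk⇔ (QM-∘ g φ)
  (λ q → QM-resp-≗ (λ x → cong φ (fun-inv g x)) (QM-∘ (invIsom g) (λ x → φ (fun g x)) q))

InP-cong : ∀ {n} {P P' : V n → Set} {φ ψ : Form n} → (QM φ ⇔ QM ψ) → (∀ x → singU φ x ⇔ singU ψ x) →
  (∀ x → P x ⇔ P' x) → InP P φ ⇔ InP P' ψ
InP-cong QM⇔ sing⇔ P⇔P' = mk⇔
  (λ { (q , s) → to QM⇔ q , λ x → ⇔.trans (⇔.sym (sing⇔ x)) (⇔.trans (s x) (P⇔P' x)) })
  (λ { (q , s) → from QM⇔ q , λ x → ⇔.trans (sing⇔ x) (⇔.trans (s x) (⇔.sym (P⇔P' x))) })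

singU-≗ : ∀ {n} {φ ψ : Form n} → φ ≗F ψ → ∀ x → singU φ x ⇔ singU ψ x
singU-≗ φ≗ψ x = mk⇔ (λ { (u , e) → u , trans (sym (φ≗ψ x)) e }) (λ { (u , e) → u , trans (φ≗ψ x) e })

InP-resp-≗ : ∀ {n} {P : V n → Set} {φ ψ : Form n} → φ ≗F ψ → InP P φ ⇔ InP P ψ
InP-resp-≗ φ≗ψ =
  InP-cong (mk⇔ (QM-resp-≗ φ≗ψ) (QM-resp-≗ (λ x → sym (φ≗ψ x)))) (singU-≗ φ≗ψ) (λ _ → ⇔.refl)

InP-resp-⇔ : ∀ {n} {P P' : V n → Set} {φ : Form n} → (∀ x → P x ⇔ P' x) → InP P φ ⇔ InP P' φ
InP-resp-⇔ = InP-cong ⇔.refl (λ _ → ⇔.refl)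

InP-agree-on-U : ∀ {n} (g₁ g₂ : Isom n) → (∀ x → InU x → fun g₁ x ≡ fun g₂ x) → (P : V n → Set) (φ : Form n) →
  InP P (λ x → φ (fun g₁ x)) ⇔ InP P (λ x → φ (fun g₂ x))
InP-agree-on-U g₁ g₂ agree P φ = InP-cong
  (⇔.trans (⇔.sym (QM-∘⇔ g₁ φ)) (QM-∘⇔ g₂ φ))
  (λ x → mk⇔ (λ { (u , e) → u , trans (cong φ (sym (agree x u))) e }) (λ { (u , e) → u , trans (cong φ (agree x u)) e }))
  (λ _ → ⇔.refl)

InP-∘ : ∀ {n} (g : Isom n) → (∀ x → InU x ⇔ InU (fun g x)) → (P P' : V n → Set) →
  (∀ x → P' x ⇔ P (fun g x)) → (φ : Form n) → InP P φ ⇔ InP P' (λ x → φ (fun g x))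
InP-∘ g g-U P P' P'⇔P∘g φ = mk⇔
  (λ { (q , s) → to (QM-∘⇔ g φ) q , λ x →
       ⇔.trans (sing-∘ x) (⇔.trans (s (fun g x)) (⇔.sym (P'⇔P∘g x))) })
  (λ { (q , s) → from (QM-∘⇔ g φ) q , λ y →
       ⇔.trans (sing-inv y) (⇔.trans (s (inv g y)) (⇔.trans (P'⇔P∘g (inv g y)) (P-inv y))) })
  where
  sing-∘ : ∀ x → singU (λ z → φ (fun g z)) x ⇔ singU φ (fun g x)
  sing-∘ x = mk⇔ (λ { (u , e) → to (g-U x) u , e }) (λ { (u , e) → from (g-U x) u , e })
  sing-inv : ∀ y → singU φ y ⇔ singU (λ z → φ (fun g z)) (inv g y)
  sing-inv y = mk⇔ (λ { (u , e) → from (g-U (inv g y)) (subst InU (sym (fun-inv g y)) u) , trans (cong φ (fun-inv g y)) e })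
                   (λ { (u , e) → subst InU (fun-inv g y) (to (g-U (inv g y)) u) , trans (cong φ (sym (fun-inv g y))) e })
  P-inv : ∀ y → P (fun g (inv g y)) ⇔ P y
  P-inv y = mk⇔ (subst P (fun-inv g y)) (subst P (sym (fun-inv g y)))

singU-φ[] : ∀ {n} (r : V n) x → singU φ[ r ] x ⇔ (InU x × (dot (proj₁ x) (proj₂ r) ≡ false))
singU-φ[] r (a , b) = mk⇔ (λ { (refl , e) → refl , trans (sym (φ[]-on-U r a)) e })
                          (λ { (refl , e) → refl , trans (φ[]-on-U r a) e })

InP-φ[] : ∀ {k} {H : Hyp (suc k)} {h} → HasNormal h H → (r : V (suc k)) →
  InP (memH H) φ[ r ] ⇔ ((φ₀ r ≡ true) × (proj₂ r ≡ h))
InP-φ[] {H = H} {h} normal r = mk⇔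
  (λ { (r∈𝒬 , sing⇔H) → QM⇒arf r r∈𝒬 , dot-ext _ _ λ a → ≡-by-false (mk⇔
        (λ e → proj₂ (to (normal (a , zeros)) (to (sing⇔H (a , zeros)) (from (singU-φ[] r (a , zeros)) (refl , e)))))
        (λ e → proj₂ (to (singU-φ[] r (a , zeros)) (from (sing⇔H (a , zeros)) (from (normal (a , zeros)) (refl , e)))))) })
  (λ { (arf , refl) → arf⇒QM r arf , λ x → ⇔.trans (singU-φ[] r x) (⇔.sym (normal x)) })

hyperplane-normal : ∀ {k} (H : Hyp (suc k)) → Σ (Vec₂ (suc k)) λ h → (isZero h ≡ false) × HasNormal h H
hyperplane-normal (S , S⊂U) = h , h≢0 , normal
  where
  found = orthogonal-outside-U (Subsp.basis S) (Subsp.indep S)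
  v = proj₁ found
  h = proj₂ v
  v⊥S = proj₁ (proj₂ found)
  h≢0 = proj₂ (proj₂ found)
  ws = Subsp.basis S
  ws⊂U : ∀ c → InU (lin c ws)
  ws⊂U c = S⊂U _ (c , refl)
  ws⊥h : ∀ c → dot (proj₁ (lin c ws)) h ≡ false
  ws⊥h c = trans (sym (B-on-U v _ (ws⊂U c))) (isOrthogonal⇒B-span v ws v⊥S c)
  normal : HasNormal h (S , S⊂U)
  normal x = mk⇔
    (λ { (c , refl) → ws⊂U c , ws⊥h c })
    (λ { (x∈U , x⊥h) → let (c , e) = independent-hyperplane-spans ws (Subsp.indep S) ws⊂U h h≢0 ws⊥h (proj₁ x) x⊥h
                        in c , trans e (cong (proj₁ x ,_) (sym x∈U)) })

non-orthogonal-unit : ∀ {n} (h : Vec₂ n) → isZero h ≡ false → Σ (Vec₂ n) λ u → dot u h ≡ true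
non-orthogonal-unit h h≢0 = unit i , trans (dot-unitˡ i h) hᵢ
  where
  i = proj₁ (nonzero-coordinate h h≢0)
  hᵢ = proj₂ (nonzero-coordinate h h≢0)

P-nonempty : ∀ {k} (H : Hyp (suc k)) → Σ (Form (suc k)) (InP (memH H))
P-nonempty H = φ[ u , h ] , from (InP-φ[] {H = H} normal (u , h)) (u·h , refl)
  where
  h = proj₁ (hyperplane-normal H)
  normal = proj₂ (proj₂ (hyperplane-normal H))
  u = proj₁ (non-orthogonal-unit h (proj₁ (proj₂ (hyperplane-normal H))))
  u·h = proj₂ (non-orthogonal-unit h (proj₁ (proj₂ (hyperplane-normal H))))

toBool : Fin 2 → Bool
toBool zero = false
toBool (suc zero) = true

fromBool : Bool → Fin 2
fromBool false = zero
fromBool true = suc zero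

decode : ∀ k → Fin (2 ^ k) → Vec₂ k
decode zero _ = []
decode (suc k) i = toBool (proj₁ (remQuot {2} (2 ^ k) i)) ∷ decode k (proj₂ (remQuot {2} (2 ^ k) i))

encode : ∀ k → Vec₂ k → Fin (2 ^ k)
encode zero [] = zero
encode (suc k) (b ∷ c) = combine (fromBool b) (encode k c)

decode-encode : ∀ k c → decode k (encode k c) ≡ c
decode-encode zero [] = refl
decode-encode (suc k) (b ∷ c) =
  trans (cong (λ qr → toBool (proj₁ qr) ∷ decode k (proj₂ qr)) (remQuot-combine {2} {2 ^ k} (fromBool b) (encode k c)))
        (cong₂ _∷_ (toBool-fromBool b) (decode-encode k c))
  where
  toBool-fromBool : ∀ b → toBool (fromBool b) ≡ b
  toBool-fromBool false = refl
  toBool-fromBool true = refl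

encode-decode : ∀ k i → encode k (decode k i) ≡ i
encode-decode zero zero = refl
encode-decode (suc k) i =
  trans (cong₂ combine (fromBool-toBool (proj₁ (remQuot {2} (2 ^ k) i))) (encode-decode k (proj₂ (remQuot {2} (2 ^ k) i))))
        (combine-remQuot {2} (2 ^ k) i)
  where
  fromBool-toBool : ∀ i → fromBool (toBool i) ≡ i
  fromBool-toBool zero = refl
  fromBool-toBool (suc zero) = refl

Card-2^ : ∀ {A : Set} (_≈_ : A → A → Set) (P : A → Set) k (e : Vec₂ k → A) →
  (∀ c → P (e c)) → (∀ c c' → e c ≈ e c' → c ≡ c') → (∀ a → P a → Σ (Vec₂ k) λ c → a ≈ e c) →
  Card _≈_ P (2 ^ k)
Card-2^ _≈_ P k e e∈P e-injective e-onto = xs , xs∈P , xs-injective , xs-onto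
  where
  xs = tabulate (λ i → e (decode k i))
  lookup-xs : ∀ i → lookup xs i ≡ e (decode k i)
  lookup-xs i = lookup∘tabulate (λ i → e (decode k i)) i
  xs∈P : ∀ i → P (lookup xs i)
  xs∈P i = subst P (sym (lookup-xs i)) (e∈P (decode k i))
  xs-injective : ∀ i j → lookup xs i ≈ lookup xs j → i ≡ j
  xs-injective i j r = trans (sym (encode-decode k i))
    (trans (cong (encode k) (e-injective _ _ (subst₂ _≈_ (lookup-xs i) (lookup-xs j) r))) (encode-decode k j))
  xs-onto : ∀ a → P a → Σ (Fin (2 ^ k)) λ i → a ≈ lookup xs i
  xs-onto a a∈P = let (c , r) = e-onto a a∈P in
    encode k c , subst (a ≈_) (sym (trans (lookup-xs (encode k c)) (cong e (decode-encode k c)))) r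

Card-resp-⇔ : ∀ {A : Set} {_≈_ : A → A → Set} {P P' : A → Set} {k} →
  (∀ a → P a ⇔ P' a) → Card _≈_ P k → Card _≈_ P' k
Card-resp-⇔ P⇔P' (xs , xs∈P , xs-injective , xs-onto) =
  xs , (λ i → to (P⇔P' _) (xs∈P i)) , xs-injective , (λ a a∈P' → xs-onto a (from (P⇔P' a) a∈P'))

-- P_H = { φ[ u + t , h ] | (t , 0) ∈ H } for any fixed u with u · h = 1.
module PEnumeration {k} {H : Hyp (suc k)} {h} (normal : HasNormal h H) (u : Vec₂ (suc k)) (u·h : dot u h ≡ true) where

  private
    ws = Subsp.basis (proj₁ H)
    t : Vec₂ k → Vec₂ (suc k)
    t c = proj₁ (lin c ws)
    span-in-H : ∀ c → InU (lin c ws) × (dot (t c) h ≡ false)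
    span-in-H c = to (normal (lin c ws)) (c , refl)

  P-element : Vec₂ k → Form (suc k)
  P-element c = φ[ u ⊕v t c , h ]

  P-element-∈ : ∀ c → InP (memH H) (P-element c)
  P-element-∈ c = from (InP-φ[] {H = H} normal _)
    (trans (dot-distribʳ-⊕v u (t c) h) (cong₂ _xor_ u·h (proj₂ (span-in-H c))) , refl)

  P-element-injective : ∀ c c' → P-element c ≗F P-element c' → c ≡ c'
  P-element-injective c c' e≗ = independent-injective ws (Subsp.indep (proj₁ H)) c c' (begin
    lin c ws        ≡⟨ on-U (lin c ws) (proj₁ (span-in-H c)) ⟩
    (t c , zeros)   ≡⟨ cong (_, zeros) (⊕v.+-cancelˡ-≡ u (cong proj₁ (φ[]-injective e≗))) ⟩
    (t c' , zeros)  ≡⟨ sym (on-U (lin c' ws) (proj₁ (span-in-H c'))) ⟩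
    lin c' ws       ∎)
    where
    open ≡-Reasoning
    on-U : ∀ (x : V (suc k)) → InU x → x ≡ (proj₁ x , zeros)
    on-U (a , b) refl = refl

  -- ψ = φ[ r ] with r₂ = h and r₁ · h = 1, so (r₁ + u) · h = 0 and (r₁ + u , 0) = lin c ws for some c.
  P-element-onto : ∀ ψ → InP (memH H) ψ → Σ (Vec₂ k) λ c → ψ ≗F P-element c
  P-element-onto ψ ψ∈P = c , λ v → trans (ψ≗ v) (cong (λ z → φ[ z ] v) r≡)
    where
    rep = QM⇒φ[] ψ (proj₁ ψ∈P)
    r = proj₁ rep
    ψ≗ = proj₁ (proj₂ rep)
    r∈P = to (InP-φ[] {H = H} normal r) (to (InP-resp-≗ ψ≗) ψ∈P)
    r₁+u⊥h : dot (proj₁ r ⊕v u) h ≡ false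
    r₁+u⊥h = trans (dot-distribʳ-⊕v (proj₁ r) u h)
      (cong₂ _xor_ (trans (cong (dot (proj₁ r)) (sym (proj₂ r∈P))) (proj₁ r∈P)) u·h)
    in-H = from (normal (proj₁ r ⊕v u , zeros)) (refl , r₁+u⊥h)
    c = proj₁ in-H
    r≡ : r ≡ (u ⊕v t c , h)
    r≡ = cong₂ _,_ (sym (trans (cong (λ z → u ⊕v proj₁ z) (proj₂ in-H))
                               (trans (cong (u ⊕v_) (⊕v-comm (proj₁ r) u)) (⊕v.x+[x+y]≡y u (proj₁ r)))))
                   (proj₂ r∈P)

P-card : ∀ {k} {H : Hyp (suc k)} {h} → HasNormal h H → isZero h ≡ false → Card _≗F_ (InP (memH H)) (2 ^ k)
P-card {k} {H} {h} normal h≢0 = Card-2^ _≗F_ (InP (memH H)) k P-element P-element-∈ P-element-injective P-element-onto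
  where open PEnumeration {H = H} normal (proj₁ (non-orthogonal-unit h h≢0)) (proj₂ (non-orthogonal-unit h h≢0))

-- (a) X_U is transitive on 𝒬⁻

φ₀-Rmap : ∀ {n} (Q : Mat n) → (∀ b → dot (vecMat b Q) b ≡ false) → ∀ y → φ₀ (Rmap Q y) ≡ φ₀ y
φ₀-Rmap Q alternating (a , b) =
  trans (dot-distribʳ-⊕v a (vecMat b Q) b) (trans (cong (dot a b xor_) (alternating b)) (xor-identityʳ (dot a b)))

L-step : ∀ {n} (p q : V n) → isZero (proj₂ p) ≡ false → isZero (proj₂ q) ≡ false →
  Σ (Mat n) λ T → Σ (IsInvPair T T) λ TT → proj₂ (Lmap T T p) ≡ proj₂ q
L-step (p₁ , p₂) (q₁ , q₂) p₂≢0 q₂≢0 = T , TT ,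
  dot-ext _ _ λ x → trans (sym (dot-vecMat x T p₂)) (proj₂ (proj₂ transv) x)
  where
  transv = transvection-between p₂ q₂ p₂≢0 q₂≢0
  T = proj₁ transv
  TT = proj₁ (proj₂ transv)

-- With s = p₁ + q₁ (so s · q₂ = φ₀ p + φ₀ q = 0) and q₂ · u = 1, the element of R with Q = u ⊗ s + s ⊗ u
-- adds s to p₁.
R-step : ∀ {n} (p₁ q₁ q₂ : Vec₂ n) → dot p₁ q₂ ≡ true → dot q₁ q₂ ≡ true →
  Σ (Mat n) λ Q → (transpose Q ≡ Q) × (∀ b → dot (vecMat b Q) b ≡ false) × (Rmap Q (p₁ , q₂) ≡ (q₁ , q₂))
R-step p₁ q₁ q₂ p·q₂ q·q₂ = symOuter u s , symOuter-symmetric u s , symOuter-alternating u s ,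
  cong (_, q₂) (trans (cong (p₁ ⊕v_) q₂Q≡s) (⊕v.x+[x+y]≡y p₁ q₁))
  where
  s = p₁ ⊕v q₁
  u = proj₁ (non-orthogonal-unit q₂ (arf⇒nonzero (q₁ , q₂) q·q₂))
  q₂·u : dot q₂ u ≡ true
  q₂·u = trans (dot-comm q₂ u) (proj₂ (non-orthogonal-unit q₂ (arf⇒nonzero (q₁ , q₂) q·q₂)))
  q₂·s : dot q₂ s ≡ false
  q₂·s = trans (dot-distribˡ-⊕v p₁ q₁ q₂)
               (cong₂ _xor_ (trans (dot-comm q₂ p₁) p·q₂) (trans (dot-comm q₂ q₁) q·q₂))
  q₂Q≡s : vecMat q₂ (symOuter u s) ≡ s
  q₂Q≡s = trans (trans (vecMat-+M q₂ (outer u s) (outer s u)) (cong₂ _⊕v_ (vecMat-outer q₂ u s) (vecMat-outer q₂ s u)))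
                (trans (cong₂ (λ a b → a ·v s ⊕v b ·v u) q₂·u q₂·s) (⊕v.+-identityʳ s))

XU-transitive : ∀ {k} (φ ψ : Form (suc k)) → QM φ → QM ψ → Σ (Isom (suc k)) λ g → InXU g × (act g φ ≗F ψ)
XU-transitive φ ψ φ∈𝒬 ψ∈𝒬 = compIsom gL gR , Lmap-U {A = T} {T} (proj₁ TT) , act≗
  where
  repφ = QM⇒φ[] φ φ∈𝒬
  repψ = QM⇒φ[] ψ ψ∈𝒬
  p = proj₁ repφ
  q = proj₁ repψ
  arf-p = proj₂ (proj₂ repφ)
  arf-q = proj₂ (proj₂ repψ)
  L = L-step p q (arf⇒nonzero p arf-p) (arf⇒nonzero q arf-q)
  T = proj₁ L
  TT = proj₁ (proj₂ L)
  gL = LIsom TT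
  p′ = Lmap T T p
  arf-p′ : dot (proj₁ p′) (proj₂ q) ≡ true
  arf-p′ = trans (cong (dot (proj₁ p′)) (sym (proj₂ (proj₂ L)))) (trans (dot-Lmap (proj₁ TT) (proj₁ p) (proj₂ p)) arf-p)
  R = R-step (proj₁ p′) (proj₁ q) (proj₂ q) arf-p′ arf-q
  Q = proj₁ R
  gR = RIsom (proj₁ (proj₂ R))
  Rp′≡q : Rmap Q p′ ≡ q
  Rp′≡q = trans (cong (λ b → Rmap Q (proj₁ p′ , b)) (proj₂ (proj₂ L))) (proj₂ (proj₂ (proj₂ R)))
  act≗ : act (compIsom gL gR) φ ≗F ψ
  act≗ x = begin
    φ (Lmap T T (Rmap Q x))       ≡⟨ proj₁ (proj₂ repφ) _ ⟩
    φ[ p ] (Lmap T T (Rmap Q x))  ≡⟨ φ[]-isometry gL (λ { (a , b) → dot-Lmap (proj₁ TT) a b }) p (Rmap Q x) ⟩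
    φ[ p′ ] (Rmap Q x)            ≡⟨ φ[]-isometry gR (φ₀-Rmap Q (proj₁ (proj₂ (proj₂ R)))) p′ x ⟩
    φ[ Rmap Q p′ ] x              ≡⟨ cong (λ r → φ[ r ] x) Rp′≡q ⟩
    φ[ q ] x                      ≡⟨ sym (proj₁ (proj₂ repψ) x) ⟩
    ψ x                           ∎
    where open ≡-Reasoning

-- (b) P_H = { φ_c | c ∈ H }

shift-φ[] : ∀ {n} (φ : Form n) (p c : V n) → φ ≗F φ[ p ] → shift φ c ≗F φ[ p ⊕ c ]
shift-φ[] φ p c φ≗ v = begin
  φ v xor (B v c ∧ B v c)            ≡⟨ cong₂ _xor_ (φ≗ v) (∧-idem (B v c)) ⟩
  (φ₀ v xor B v p) xor B v c         ≡⟨ xor-assoc (φ₀ v) (B v p) (B v c) ⟩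
  φ₀ v xor (B v p xor B v c)         ≡⟨ cong (φ₀ v xor_) (sym (B-distribˡ-⊕ p c v)) ⟩
  φ₀ v xor B v (p ⊕ c)               ∎
  where open ≡-Reasoning

module Singular {k} {φ : Form (suc k)} {p : V (suc k)} (φ≗φ[p] : φ ≗F φ[ p ]) (arf : φ₀ p ≡ true) where

  p₂≢0 : isZero (proj₂ p) ≡ false
  p₂≢0 = arf⇒nonzero p arf

  H : Hyp (suc k)
  H = proj₁ (hyperplane (proj₂ p) p₂≢0)

  normal : HasNormal (proj₂ p) H
  normal = proj₂ (hyperplane (proj₂ p) p₂≢0)

  singU⇔H : ∀ x → singU φ x ⇔ memH H x
  singU⇔H x = ⇔.trans (singU-≗ φ≗φ[p] x) (⇔.trans (singU-φ[] p x) (⇔.sym (normal x)))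

  -- φ_c = φ[ p + c ] lies in P_H iff p₂ + c₂ = p₂ and φ₀ (p + c) = 1, i.e. iff c ∈ U and
  -- φ c = φ₀ (p + c) + 1 = 0.
  shift-in-P⇔ : ∀ c → InP (singU φ) (shift φ c) ⇔ singU φ c
  shift-in-P⇔ (c₁ , c₂) = ⇔.trans (InP-resp-⇔ singU⇔H) (⇔.trans (InP-resp-≗ (shift-φ[] φ p c φ≗φ[p]))
    (⇔.trans (InP-φ[] {H = H} normal (p ⊕ c)) (mk⇔
      (λ { (arf′ , p₂+c₂≡p₂) → ⊕v.+-cancelˡ-≡ (proj₂ p) (trans p₂+c₂≡p₂ (sym (⊕v.+-identityʳ (proj₂ p)))) ,
                                trans φc≡ (to (x≡true⇔x+1≡false _) arf′) })
      (λ { (c∈U , φc≡0) → from (x≡true⇔x+1≡false _) (trans (sym φc≡) φc≡0) ,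
                          trans (cong (proj₂ p ⊕v_) c∈U) (⊕v.+-identityʳ (proj₂ p)) }))))
    where
    c = c₁ , c₂
    φc≡ : φ c ≡ φ₀ (p ⊕ c) xor true
    φc≡ = trans (φ≗φ[p] c) (trans (φ[]-translate p c) (cong₂ _xor_ (cong φ₀ (⊕-comm c p)) arf))

  P-sing-card : Card _≗F_ (InP (singU φ)) (2 ^ k)
  P-sing-card = Card-resp-⇔ {_≈_ = _≗F_} (λ ψ → InP-resp-⇔ (λ x → ⇔.sym (singU⇔H x))) (P-card {H = H} normal p₂≢0)

shift-in-P⇔ : ∀ {k} (φ : Form (suc k)) → QM φ → ∀ c → InP (singU φ) (shift φ c) ⇔ singU φ c
shift-in-P⇔ φ φ∈𝒬 = Singular.shift-in-P⇔ (proj₁ (proj₂ (QM⇒φ[] φ φ∈𝒬))) (proj₂ (proj₂ (QM⇒φ[] φ φ∈𝒬)))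

P-sing-card : ∀ {k} (φ : Form (suc k)) → QM φ → Card _≗F_ (InP (singU φ)) (2 ^ k)
P-sing-card φ φ∈𝒬 = Singular.P-sing-card (proj₁ (proj₂ (QM⇒φ[] φ φ∈𝒬))) (proj₂ (proj₂ (QM⇒φ[] φ φ∈𝒬)))

-- (c) 𝒫 is a system of imprimitivity for X_U

P-covers : ∀ {k} (φ : Form (suc k)) → QM φ → Σ (Hyp (suc k)) λ H → InP (memH H) φ
P-covers φ φ∈𝒬 = H , φ∈𝒬 , singU⇔H
  where open Singular (proj₁ (proj₂ (QM⇒φ[] φ φ∈𝒬))) (proj₂ (proj₂ (QM⇒φ[] φ φ∈𝒬)))

P-determines-H : ∀ {n} (H H' : Hyp n) (φ : Form n) → InP (memH H) φ → InP (memH H') φ → ∀ x → memH H x ⇔ memH H' x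
P-determines-H H H' φ (_ , sing⇔H) (_ , sing⇔H') x = ⇔.trans (⇔.sym (sing⇔H x)) (sing⇔H' x)

P-injective : ∀ {k} (H H' : Hyp (suc k)) → (∀ φ → InP (memH H) φ ⇔ InP (memH H') φ) → ∀ x → memH H x ⇔ memH H' x
P-injective H H' P≡P' = P-determines-H H H' φ φ∈P (to (P≡P' φ) φ∈P)
  where
  φ = proj₁ (P-nonempty H)
  φ∈P = proj₂ (P-nonempty H)

image-hyperplane : ∀ {n} (g : Isom n) → InXU g → (H : Hyp n) → Σ (Hyp n) λ H' → ∀ x → memH H' x ⇔ imgH g H x
image-hyperplane g g-U (S , S⊂U) = (S′ , S′⊂U) , λ x → mk⇔
    (λ { (c , e) → c , trans (sym (inv-fun g _)) (cong (inv g) (trans (sym (lin-map (fun g) (additive g) c ws)) e)) })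
    (λ { (c , e) → c , trans (lin-map (fun g) (additive g) c ws) (trans (cong (fun g) e) (fun-inv g x)) })
  where
  ws = Subsp.basis S
  S′ : Subsp _ _
  S′ = record { basis = map (fun g) ws ; indep = independent-map (fun g) (additive g) (fun-kernel g) ws (Subsp.indep S) }
  S′⊂U : ∀ x → x ∈S S′ → InU x
  S′⊂U x (c , e) = subst InU (trans (sym (lin-map (fun g) (additive g) c ws)) e) (to (g-U (lin c ws)) (S⊂U _ (c , refl)))

inv-U : ∀ {n} (g : Isom n) → InXU g → ∀ x → InU x ⇔ InU (inv g x)
inv-U g g-U x = mk⇔ (λ u → from (g-U (inv g x)) (subst InU (sym (fun-inv g x)) u))
                    (λ u → subst InU (fun-inv g x) (to (g-U (inv g x)) u))

P-equivariant : ∀ {n} (g : Isom n) → InXU g → ∀ (H : Hyp n) (φ : Form n) → InP (memH H) φ ⇔ InP (imgH g H) (act g φ)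
P-equivariant g g-U H φ = InP-∘ (invIsom g) (inv-U g g-U) (memH H) (imgH g H) (λ x → ⇔.refl) φ

-- (d) The actions of L on 𝒫 and of GL(U) on ℋ

GL-transitive : ∀ {k} (H H' : Hyp (suc k)) →
  Σ (Mat (suc k)) λ A → Σ (Mat (suc k)) λ A' → IsInvPair A A' × (∀ x → memH H' x ⇔ imgA A' H x)
GL-transitive H H' = T , T , TT , λ x → mk⇔
    (λ x∈H' → let (x∈U , x⊥h') = to (normal' x) x∈H' in
              x∈U , from (normal (vecMat (proj₁ x) T , zeros)) (refl , trans (T-moves (proj₁ x)) x⊥h'))
    (λ { (x∈U , xT∈H) → from (normal' x) (x∈U , trans (sym (T-moves (proj₁ x))) (proj₂ (to (normal _) xT∈H))) })
  where
  h = proj₁ (hyperplane-normal H)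
  normal = proj₂ (proj₂ (hyperplane-normal H))
  h' = proj₁ (hyperplane-normal H')
  normal' = proj₂ (proj₂ (hyperplane-normal H'))
  transv = transvection-between h h' (proj₁ (proj₂ (hyperplane-normal H))) (proj₁ (proj₂ (hyperplane-normal H')))
  T = proj₁ transv
  TT = proj₁ (proj₂ transv)
  T-moves = proj₂ (proj₂ transv)

L-equivariant : ∀ {k} (A A' : Mat (suc k)) → IsInvPair A A' → ∀ (H : Hyp (suc k)) (φ : Form (suc k)) →
  InP (memH H) φ ⇔ InP (imgA A' H) (λ x → φ (Lmap A' A x))
L-equivariant A A' (AA'≡I , A'A≡I) H φ =
  InP-∘ (LIsom (A'A≡I , AA'≡I)) (Lmap-U A'A≡I) (memH H) (imgA A' H) image⇔ φ
  where
  image⇔ : ∀ x → imgA A' H x ⇔ memH H (Lmap A' A x)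
  image⇔ (x₁ , x₂) = mk⇔
    (λ { (x∈U , m) → subst (λ z → memH H (vecMat x₁ A' , z)) (sym (trans (cong (λ b → vecMat b (transpose A)) x∈U)
                                                                           (vecMat-zeroˡ (transpose A)))) m })
    (λ m → let x∈U = from (Lmap-U A'A≡I (x₁ , x₂)) (proj₂ H _ m) in
           x∈U , subst (λ z → memH H (vecMat x₁ A' , z)) (trans (cong (λ b → vecMat b (transpose A)) x∈U)
                                                               (vecMat-zeroˡ (transpose A))) m)

P-size : ∀ {k} (H : Hyp (suc k)) → Card _≗F_ (InP (memH H)) (2 ^ k)
P-size H = P-card {H = H} (proj₂ (proj₂ (hyperplane-normal H))) (proj₁ (proj₂ (hyperplane-normal H)))

-- Compose the GL(U)-element carrying H' to H with the equivariance of H ↦ P_H.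
L-transitive : ∀ {k} (H H' : Hyp (suc k)) →
  Σ (Mat (suc k)) λ A → Σ (Mat (suc k)) λ A' → IsInvPair A A' ×
    (∀ (ψ : Form (suc k)) → InP (memH H') ψ ⇔ InP (memH H) (λ x → ψ (Lmap A A' x)))
L-transitive H H' = A' , A , (A'A≡I , AA'≡I) , λ ψ →
  ⇔.trans (L-equivariant A A' (AA'≡I , A'A≡I) H' ψ) (InP-resp-⇔ (λ x → ⇔.sym (H≡H'^A x)))
  where
  GL = GL-transitive H' H
  A = proj₁ GL
  A' = proj₁ (proj₂ GL)
  AA'≡I = proj₁ (proj₁ (proj₂ (proj₂ GL)))
  A'A≡I = proj₂ (proj₁ (proj₂ (proj₂ GL)))
  H≡H'^A = proj₂ (proj₂ (proj₂ GL))

-- (e) The kernel of X_U on 𝒫 is R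

-- (a , 0) ∈ sing(φ[ u , h ] ∘ F) iff (f a) · h = 0; stabilising P_H with normal h makes this a · h = 0.
stabilises-P⇒identity-on-U : ∀ {k} (F : V (suc k) → V (suc k)) (f : Vec₂ (suc k) → Vec₂ (suc k)) →
  (∀ a → F (a , zeros) ≡ (f a , zeros)) →
  (∀ (H : Hyp (suc k)) (φ : Form (suc k)) → InP (memH H) φ → InP (memH H) (λ x → φ (F x))) →
  ∀ a → f a ≡ a
stabilises-P⇒identity-on-U F f F-on-U stabilises a =
  dot-ext (f a) a λ h → trans (dot-comm h (f a)) (trans (same-side h) (dot-comm a h))
  where
  same-side : ∀ h → dot (f a) h ≡ dot a h
  same-side h with isZero h in h≡0
  ... | true = trans (cong (dot (f a)) (isZero⇒≡zeros h h≡0))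
                     (trans (dot-zeroʳ (f a)) (sym (trans (cong (dot a) (isZero⇒≡zeros h h≡0)) (dot-zeroʳ a))))
  ... | false = ≡-by-false (mk⇔
        (λ e → proj₂ (to (normal (a , zeros)) (to (sing⇔H (a , zeros)) (refl , trans φF≡ e))))
        (λ e → trans (sym φF≡) (proj₂ (from (sing⇔H (a , zeros)) (from (normal (a , zeros)) (refl , e))))))
    where
    H = proj₁ (hyperplane h h≡0)
    normal = proj₂ (hyperplane h h≡0)
    u = proj₁ (non-orthogonal-unit h h≡0)
    φ∈P = from (InP-φ[] {H = H} normal (u , h)) (proj₂ (non-orthogonal-unit h h≡0) , refl)
    sing⇔H = proj₂ (stabilises H φ[ u , h ] φ∈P)
    φF≡ : φ[ u , h ] (F (a , zeros)) ≡ dot (f a) h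
    φF≡ = trans (cong φ[ u , h ] (F-on-U a)) (φ[]-on-U (u , h) (f a))

-- An isometry fixing U pointwise is (a , b) ↦ (a + b Q , b) with Q the matrix of b ↦ (g (0 , b))₁, and
-- preserving B forces Q = Qᵀ.
module _ {n} (g : Isom n) (fixes-U : ∀ a → fun g (a , zeros) ≡ (a , zeros)) where

  private
    m : Vec₂ n → Vec₂ n
    m b = proj₁ (fun g (zeros , b))
    m-additive : ∀ u v → m (u ⊕v v) ≡ m u ⊕v m v
    m-additive u v =
      cong proj₁ (trans (cong (λ z → fun g (z , u ⊕v v)) (sym (⊕v-self zeros))) (additive g (zeros , u) (zeros , v)))
    Q = proj₁ (additive⇒matrix m m-additive)

  identity-on-U⇒second-coordinate : ∀ b → proj₂ (fun g (zeros , b)) ≡ b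
  identity-on-U⇒second-coordinate b = dot-ext _ _ λ a → begin
    dot a (proj₂ (fun g (zeros , b)))          ≡⟨ sym (B-U a _) ⟩
    B (a , zeros) (fun g (zeros , b))          ≡⟨ cong (λ y → B y (fun g (zeros , b))) (sym (fixes-U a)) ⟩
    B (fun g (a , zeros)) (fun g (zeros , b))  ≡⟨ isometry g (a , zeros) (zeros , b) ⟩
    B (a , zeros) (zeros , b)                  ≡⟨ B-U a (zeros , b) ⟩
    dot a b                                    ∎
    where open ≡-Reasoning

  identity-on-U⇒on-0b : ∀ b → fun g (zeros , b) ≡ (vecMat b Q , b)
  identity-on-U⇒on-0b b = cong₂ _,_ (proj₂ (additive⇒matrix m m-additive) b) (identity-on-U⇒second-coordinate b)

  identity-on-U⇒R : InR g
  identity-on-U⇒R = Q , symmetric-of-self-adjoint Q Q-self-adjoint , g≡Rmap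
    where
    Q-self-adjoint : ∀ x y → dot (vecMat y Q) x ≡ dot y (vecMat x Q)
    Q-self-adjoint x y = Xor.x+y≡0⇒x≡y _ _ (begin
      dot (vecMat y Q) x xor dot y (vecMat x Q)    ≡⟨ sym (cong₂ B (identity-on-U⇒on-0b y) (identity-on-U⇒on-0b x)) ⟩
      B (fun g (zeros , y)) (fun g (zeros , x))    ≡⟨ isometry g (zeros , y) (zeros , x) ⟩
      dot zeros x xor dot y zeros                  ≡⟨ cong₂ _xor_ (dot-zeroˡ x) (dot-zeroʳ y) ⟩
      false                                        ∎)
      where open ≡-Reasoning
    g≡Rmap : ∀ v → fun g v ≡ Rmap Q v
    g≡Rmap (a , b) = begin
      fun g (a , b)                               ≡⟨ cong (fun g) (sym (cong₂ _,_ (⊕v.+-identityʳ a) (⊕v-identityˡ b))) ⟩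
      fun g ((a , zeros) ⊕ (zeros , b))           ≡⟨ additive g (a , zeros) (zeros , b) ⟩
      fun g (a , zeros) ⊕ fun g (zeros , b)       ≡⟨ cong₂ _⊕_ (fixes-U a) (identity-on-U⇒on-0b b) ⟩
      (a ⊕v vecMat b Q , zeros ⊕v b)              ≡⟨ cong (a ⊕v vecMat b Q ,_) (⊕v-identityˡ b) ⟩
      Rmap Q (a , b)                              ∎
      where open ≡-Reasoning

R-identity-on-U : ∀ {n} (g : Isom n) → InR g → ∀ x → InU x → fun g x ≡ x
R-identity-on-U g (Q , _ , g≡Rmap) (a , b) refl =
  trans (g≡Rmap (a , zeros)) (cong (_, zeros) (trans (cong (a ⊕v_) (vecMat-zeroˡ Q)) (⊕v.+-identityʳ a)))

kernel-is-R : ∀ {k} (g : Isom (suc k)) → InXU g →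
  (∀ (H : Hyp (suc k)) (φ : Form (suc k)) → InP (memH H) φ ⇔ InP (memH H) (act g φ)) ⇔ InR g
kernel-is-R {k} g g-U = mk⇔
  (λ stabilises → identity-on-U⇒R g λ a → trans (cong (fun g) (sym (inv-fixes-U stabilises a))) (fun-inv g _))
  (λ g∈R H φ → InP-agree-on-U idIsom (invIsom g)
     (λ x x∈U → trans (sym (inv-fun g x)) (cong (inv g) (R-identity-on-U g g∈R x x∈U))) (memH H) φ)
  where
  inv-on-U : ∀ a → inv g (a , zeros) ≡ (proj₁ (inv g (a , zeros)) , zeros)
  inv-on-U a = cong (proj₁ (inv g (a , zeros)) ,_) (to (inv-U g g-U (a , zeros)) refl)
  inv-fixes-U : (∀ (H : Hyp (suc k)) (φ : Form (suc k)) → InP (memH H) φ ⇔ InP (memH H) (act g φ)) →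
    ∀ a → inv g (a , zeros) ≡ (a , zeros)
  inv-fixes-U stabilises a = trans (inv-on-U a) (cong (_, zeros)
    (stabilises-P⇒identity-on-U (inv g) (λ a → proj₁ (inv g (a , zeros))) inv-on-U (λ H φ → to (stabilises H φ)) a))

matrix-on-U : ∀ {n} (f : V n → V n) → Additive f → (∀ x → InU x → InU (f x)) →
  Σ (Mat n) λ M → ∀ a → f (a , zeros) ≡ (vecMat a M , zeros)
matrix-on-U f additive-f f-U = proj₁ rep , λ a → cong₂ _,_ (proj₂ rep a) (f-U (a , zeros) refl)
  where
  rep = additive⇒matrix (λ a → proj₁ (f (a , zeros)))
    λ u v → cong proj₁ (trans (cong (λ z → f (u ⊕v v , z)) (sym (⊕v-self zeros))) (additive-f (u , zeros) (v , zeros)))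

matrix-on-U-inverse : ∀ {n} {f f' : V n → V n} {M M' : Mat n} → (∀ x → f' (f x) ≡ x) →
  (∀ a → f (a , zeros) ≡ (vecMat a M , zeros)) → (∀ a → f' (a , zeros) ≡ (vecMat a M' , zeros)) → M ·m M' ≡ idMat
matrix-on-U-inverse {f = f} {f'} {M} {M'} f'∘f≡id f-on-U f'-on-U = vecMat-ext _ _ λ x → begin
  vecMat x (M ·m M')                 ≡⟨ vecMat-·m x M M' ⟩
  vecMat (vecMat x M) M'             ≡⟨ cong proj₁ (sym (f'-on-U _)) ⟩
  proj₁ (f' (vecMat x M , zeros))    ≡⟨ cong (λ y → proj₁ (f' y)) (sym (f-on-U x)) ⟩
  proj₁ (f' (f (x , zeros)))         ≡⟨ cong proj₁ (f'∘f≡id _) ⟩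
  x                                  ≡⟨ sym (vecMat-identity x) ⟩
  vecMat x idMat                     ∎
  where open ≡-Reasoning

XU-restriction : ∀ {n} (g : Isom n) → InXU g →
  Σ (Mat n) λ A → Σ (Mat n) λ A' → IsInvPair A A' × (∀ x → InU x → inv g x ≡ Lmap A' A x)
XU-restriction {n} g g-U = A , A' ,
  (matrix-on-U-inverse {f = fun g} {inv g} (inv-fun g) A-on-U A'-on-U ,
   matrix-on-U-inverse {f = inv g} {fun g} (fun-inv g) A'-on-U A-on-U) , inv-on-U
  where
  g-on-U = matrix-on-U (fun g) (additive g) (λ x → to (g-U x))
  g⁻¹-on-U = matrix-on-U (inv g) (inv-additive g) (λ x → to (inv-U g g-U x))
  A = proj₁ g-on-U
  A-on-U = proj₂ g-on-U
  A' = proj₁ g⁻¹-on-U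
  A'-on-U = proj₂ g⁻¹-on-U
  inv-on-U : ∀ x → InU x → inv g x ≡ Lmap A' A x
  inv-on-U (a , b) refl = trans (A'-on-U a) (cong (vecMat a A' ,_) (sym (vecMat-zeroˡ (transpose A))))

XU-acts-through-L : ∀ {n} (g : Isom n) → InXU g →
  Σ (Mat n) λ A → Σ (Mat n) λ A' → IsInvPair A A' ×
    (∀ (H : Hyp n) (φ : Form n) → InP (memH H) (act g φ) ⇔ InP (memH H) (λ x → φ (Lmap A' A x)))
XU-acts-through-L g g-U = A , A' , (AA'≡I , A'A≡I) , λ H φ →
  InP-agree-on-U (invIsom g) (LIsom (A'A≡I , AA'≡I)) agree (memH H) φ
  where
  restriction = XU-restriction g g-U
  A = proj₁ restriction
  A' = proj₁ (proj₂ restriction)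
  AA'≡I = proj₁ (proj₁ (proj₂ (proj₂ restriction)))
  A'A≡I = proj₂ (proj₁ (proj₂ (proj₂ restriction)))
  agree = proj₂ (proj₂ (proj₂ restriction))

L-faithful : ∀ {k} (A A' : Mat (suc k)) → IsInvPair A A' →
  (∀ (H : Hyp (suc k)) (φ : Form (suc k)) → InP (memH H) φ ⇔ InP (memH H) (λ x → φ (Lmap A' A x))) → A ≡ idMat
L-faithful A A' (AA'≡I , _) stabilises = vecMat-ext A idMat λ x → begin
  vecMat x A                    ≡⟨ sym (A'-identity (vecMat x A)) ⟩
  vecMat (vecMat x A) A'        ≡⟨ vecMat-inverse AA'≡I x ⟩
  x                             ≡⟨ sym (vecMat-identity x) ⟩
  vecMat x idMat                ∎
  where
  open ≡-Reasoning
  A'-identity : ∀ a → vecMat a A' ≡ a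
  A'-identity = stabilises-P⇒identity-on-U (Lmap A' A) (λ a → vecMat a A')
    (λ a → cong (vecMat a A' ,_) (vecMat-zeroˡ (transpose A))) (λ H φ → to (stabilises H φ))

open import Data.Nat using (_≤_)

lemma5p23 : (n : ℕ) → 2 ≤ n →
  (∀ (φ ψ : Form n) → QM φ → QM ψ →
     Σ (Isom n) λ g → InXU g × (act g φ ≗F ψ))
  ×
  (∀ (φ : Form n) → QM φ →
     (∀ (c : V n) → InP (singU φ) (shift φ c) ⇔ singU φ c) ×
     Card _≗F_ (InP (singU φ)) (2 ^ (n ∸ 1)))
  ×
  ((∀ (φ : Form n) → QM φ → Σ (Hyp n) λ H → InP (memH H) φ) ×
   (∀ (H H' : Hyp n) (φ : Form n) → InP (memH H) φ → InP (memH H') φ →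
      ∀ x → memH H x ⇔ memH H' x) ×
   (∀ (H : Hyp n) → Σ (Form n) λ φ → InP (memH H) φ) ×
   (∀ (g : Isom n) → InXU g → ∀ (H : Hyp n) →
      Σ (Hyp n) λ H' → ∀ x → memH H' x ⇔ imgH g H x) ×
   (∀ (H H' : Hyp n) → (∀ φ → InP (memH H) φ ⇔ InP (memH H') φ) →
      ∀ x → memH H x ⇔ memH H' x) ×
   (∀ (g : Isom n) → InXU g → ∀ (H : Hyp n) (φ : Form n) →
      InP (memH H) φ ⇔ InP (imgH g H) (act g φ)))
  ×
  ((∀ (H H' : Hyp n) → Σ (Mat n) λ A → Σ (Mat n) λ A' → IsInvPair A A' ×
      (∀ x → memH H' x ⇔ imgA A' H x)) ×
   (∀ (H H' : Hyp n) → Σ (Mat n) λ A → Σ (Mat n) λ A' → IsInvPair A A' ×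
      (∀ (ψ : Form n) → InP (memH H') ψ ⇔ InP (memH H) (λ x → ψ (Lmap A A' x)))) ×
   (∀ (A A' : Mat n) → IsInvPair A A' → ∀ (H : Hyp n) (φ : Form n) →
      InP (memH H) φ ⇔ InP (imgA A' H) (λ x → φ (Lmap A' A x))) ×
   (∀ (H : Hyp n) → Card _≗F_ (InP (memH H)) (2 ^ (n ∸ 1))))
  ×
  ((∀ (g : Isom n) → InXU g →
      (∀ (H : Hyp n) (φ : Form n) → InP (memH H) φ ⇔ InP (memH H) (act g φ))
        ⇔ InR g) ×
   (∀ (g : Isom n) → InXU g →
      Σ (Mat n) λ A → Σ (Mat n) λ A' → IsInvPair A A' ×
        (∀ (H : Hyp n) (φ : Form n) →
           InP (memH H) (act g φ) ⇔ InP (memH H) (λ x → φ (Lmap A' A x)))) ×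
   (∀ (A A' : Mat n) → IsInvPair A A' →
      (∀ (H : Hyp n) (φ : Form n) →
         InP (memH H) φ ⇔ InP (memH H) (λ x → φ (Lmap A' A x))) →
      A ≡ idMat))
-- The argument needs only n ≥ 1.
lemma5p23 zero ()
lemma5p23 (suc k) _ =
  XU-transitive ,
  (λ φ φ∈𝒬 → shift-in-P⇔ φ φ∈𝒬 , P-sing-card φ φ∈𝒬) ,
  (P-covers , P-determines-H , P-nonempty , image-hyperplane , P-injective , P-equivariant) ,
  (GL-transitive , L-transitive , L-equivariant , P-size) ,
  (kernel-is-R , XU-acts-through-L , L-faithful)
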